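{- As formal power series in $x$ with coefficients in $\mathbb{Q}(t,q)$, \[ G(t,q,x)=1+\frac{e^{x(1-t)}-1}{1+q-(t+q)e^{x(1-t)}}. \]
   Context: A segmented permutation of size $n$ is a permutation $\sigma=\sigma_1\cdots\sigma_n$ of $\{1,\dots,n\}$, written as a word, together with a choice, for each position $i\in\{1,\dots,n-1\}$, of whether or not a bar is placed between $\sigma_i$ and $\sigma_{i+1}$. $SP_n$ is the set of these ($SP_0$ consists of the empty permutation only). A position $i<n$ is a segmentation if there is a bar between $\sigma_i$ and $\sigma_{i+1}$, and a descent if it is not a segmentation and $\sigma_i>\sigma_{i+1}$. $\operatorname{des}(\sigma)$, $\operatorname{seg}(\sigma)$ are the numbers of descents and segmentations. $\alpha_n(t,q)=\sum_{\sigma\in SP_n}t^{\operatorname{des}(\sigma)}q^{\operatorname{seg}(\sigma)}$ (so $\alpha_0=1$), and $G(t,q,x)=\sum_{n\ge0}\alpha_n(t,q)\frac{x^n}{n!}$. -}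

module Defs where

open import Data.Bool using (Bool; true; false; if_then_else_; not; _∧_)
open import Data.Nat as ℕ using (ℕ; zero; suc; _∸_; _!; _<ᵇ_; _≡ᵇ_)
open import Data.Nat.Properties using (_!≢0)
open import Data.Fin using (Fin; toℕ; _≟_)
open import Data.List using (List; []; _∷_; map; concatMap; length)
open import Data.Bool.ListAction using (any)
open import Data.List using (allFin)
open import Data.Product using (_×_; _,_)
open import Data.Integer using (+_)
open import Data.Rational using (ℚ; 0ℚ; 1ℚ; _+_; _*_; -_; _/_)
open import Relation.Nullary using (does)
open import Relation.Binary.PropositionalEquality using (_≡_)

sumTo : (ℕ → ℚ) → ℕ → ℚ
sumTo f zero    = f 0
sumTo f (suc n) = sumTo f n + f (suc n)

-- Coefficient ring: ℚ[[t,q]] (contains ℚ[t,q]).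
-- A value p : Poly2 gives p i j = coefficient of t^i q^j.

Poly2 : Set
Poly2 = ℕ → ℕ → ℚ

constP : ℚ → Poly2
constP c zero zero = c
constP c _    _    = 0ℚ

tP : Poly2
tP 1 0 = 1ℚ
tP _ _ = 0ℚ

qP : Poly2
qP 0 1 = 1ℚ
qP _ _ = 0ℚ

_+P_ : Poly2 → Poly2 → Poly2
(p +P r) i j = p i j + r i j

-P_ : Poly2 → Poly2
(-P p) i j = - p i j

_-P_ : Poly2 → Poly2 → Poly2
p -P r = p +P (-P r)

_*P_ : Poly2 → Poly2 → Poly2
(p *P r) i j = sumTo (λ a → sumTo (λ b → p a b * r (i ∸ a) (j ∸ b)) j) i

scaleP : ℚ → Poly2 → Poly2
scaleP c p i j = c * p i j

_^P_ : Poly2 → ℕ → Poly2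
p ^P zero  = constP 1ℚ
p ^P suc n = p *P (p ^P n)

FPS : Set
FPS = ℕ → Poly2

constS : Poly2 → FPS
constS c zero    = c
constS c (suc n) = constP 0ℚ

_+S_ : FPS → FPS → FPS
(F +S H) n = F n +P H n

_-S_ : FPS → FPS → FPS
(F -S H) n = F n -P H n

_*S_ : FPS → FPS → FPS
(F *S H) n i j = sumTo (λ k → (F k *P H (n ∸ k)) i j) n

_≈S_ : FPS → FPS → Set
F ≈S H = ∀ n i j → F n i j ≡ H n i j

invFact : ℕ → ℚ
invFact n = (+ 1 / (n !)) {{n !≢0}}

expS : Poly2 → FPS
expS c n = scaleP (invFact n) (c ^P n)

egf : (ℕ → Poly2) → FPS
egf a n = scaleP (invFact n) (a n)

allLists : {A : Set} → ℕ → List A → List (List A)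
allLists zero    xs = [] ∷ []
allLists (suc k) xs = concatMap (λ a → map (a ∷_) (allLists k xs)) xs

distinct : {n : ℕ} → List (Fin n) → Bool
distinct []      = true
distinct (a ∷ w) = not (any (λ b → does (a ≟ b)) w) ∧ distinct w

-- A segmented permutation of size n is a pair (w , bs): w = σ₁⋯σₙ is a word
-- listing a permutation of {1,…,n} (value k+1 encoded as k : Fin n), i.e. a
-- length-n word over Fin n with distinct entries; bs = b₁⋯b_{n-1} with
-- bᵢ = true iff there is a bar between σᵢ and σᵢ₊₁.
SegPerm : ℕ → Set
SegPerm n = List (Fin n) × List Bool

SP : (n : ℕ) → List (SegPerm n)
SP n = concatMap (λ w → if distinct w
                          then map (λ bs → (w , bs)) (allLists (n ∸ 1) (true ∷ false ∷ []))
                          else [])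
                 (allLists n (allFin n))

desW : {n : ℕ} → List (Fin n) → List Bool → ℕ
desW (a ∷ b ∷ w) (s ∷ bs) =
  (if s then 0 else (if toℕ b <ᵇ toℕ a then 1 else 0)) ℕ.+ desW (b ∷ w) bs
desW _ _ = 0

des : {n : ℕ} → SegPerm n → ℕ
des (w , bs) = desW w bs

segB : List Bool → ℕ
segB []           = 0
segB (true ∷ bs)  = suc (segB bs)
segB (false ∷ bs) = segB bs

seg : {n : ℕ} → SegPerm n → ℕ
seg (w , bs) = segB bs

countᵇ : {A : Set} → (A → Bool) → List A → ℕ
countᵇ p []       = 0
countᵇ p (x ∷ xs) = (if p x then 1 else 0) ℕ.+ countᵇ p xs

α : ℕ → Poly2
α n i j = (+ countᵇ (λ σ → (des σ ≡ᵇ i) ∧ (seg σ ≡ᵇ j)) (SP n)) / 1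

G : FPS
G = egf α

E : FPS
E = expS (constP 1ℚ -P tP)

oneS : FPS
oneS = constS (constP 1ℚ)

Den : FPS
Den = (constS (constP 1ℚ +P qP)) -S (constS (tP +P qP) *S E)

Num : FPS
Num = E -S oneS

{-# OPTIONS --safe #-}

-- With u = t + q and v = 1 + q, summing over the bars turns each adjacent pair of a permutation into
-- a factor u (descent: t, or a bar q) or v (ascent: 1, or a bar q), so α n is a sum of products of
-- u's and v's. Inserting the smallest letter at the n + 2 positions of a permutation of size n + 1
-- adds a factor v or u at an end or replaces one factor by u v; as ∂q u = ∂q v = 1 this gives
-- α (n + 2) = (u + v) α (n + 1) + u v ∂q α (n + 1), i.e. F = G − 1 satisfies F′ = 1 + (u + v) F + u v ∂q F.
-- With E = e^{x(1−t)}, the residual R = F (v − u E) − (E − 1) then satisfies R′ = v R + u v ∂q R and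
-- R(0) = 0; as (n + 1) R_{n+1} is determined by R_n and ℚ has characteristic 0, R = 0.
module Submission where

open import Algebra.Bundles using (CommutativeRing)

module FiniteSums {c ℓ} (R : CommutativeRing c ℓ) where

  open import Data.Nat as ℕ using (ℕ; zero; suc; _∸_; _≤_; z≤n)
  open import Data.Nat.Properties as ℕ using ()
  open import Relation.Binary.PropositionalEquality as ≡ using (_≡_)
  open CommutativeRing R
  open import Algebra.Properties.CommutativeSemigroup +-commutativeSemigroup using (interchange)
  open import Relation.Binary.Reasoning.Setoid setoid

  ∑ : (ℕ → Carrier) → ℕ → Carrier
  ∑ f zero    = f 0
  ∑ f (suc n) = ∑ f n + f (suc n)

  ∑-cong≤ : ∀ {f g} n → (∀ k → k ≤ n → f k ≈ g k) → ∑ f n ≈ ∑ g n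
  ∑-cong≤ zero    f≈g = f≈g 0 z≤n
  ∑-cong≤ (suc n) f≈g = +-cong (∑-cong≤ n (λ k k≤n → f≈g k (ℕ.m≤n⇒m≤1+n k≤n))) (f≈g (suc n) ℕ.≤-refl)

  ∑-cong : ∀ {f g} n → (∀ k → f k ≈ g k) → ∑ f n ≈ ∑ g n
  ∑-cong n f≈g = ∑-cong≤ n (λ k _ → f≈g k)

  ∑-distrib-+ : ∀ f g n → ∑ (λ k → f k + g k) n ≈ ∑ f n + ∑ g n
  ∑-distrib-+ f g zero    = refl
  ∑-distrib-+ f g (suc n) = trans (+-congʳ (∑-distrib-+ f g n)) (interchange _ _ _ _)

  *-distribˡ-∑ : ∀ x f n → x * ∑ f n ≈ ∑ (λ k → x * f k) n
  *-distribˡ-∑ x f zero    = refl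
  *-distribˡ-∑ x f (suc n) = trans (distribˡ _ _ _) (+-congʳ (*-distribˡ-∑ x f n))

  *-distribʳ-∑ : ∀ x f n → ∑ f n * x ≈ ∑ (λ k → f k * x) n
  *-distribʳ-∑ x f zero    = refl
  *-distribʳ-∑ x f (suc n) = trans (distribʳ _ _ _) (+-congʳ (*-distribʳ-∑ x f n))

  ∑-zero : ∀ {f} n → (∀ k → k ≤ n → f k ≈ 0#) → ∑ f n ≈ 0#
  ∑-zero n f≈0 = trans (∑-cong≤ n f≈0) (lemma n)
    where
    lemma : ∀ n → ∑ (λ _ → 0#) n ≈ 0#
    lemma zero    = refl
    lemma (suc n) = trans (+-congʳ (lemma n)) (+-identityʳ 0#)

  ∑-unfoldˡ : ∀ f n → ∑ f (suc n) ≈ f 0 + ∑ (λ k → f (suc k)) n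
  ∑-unfoldˡ f zero    = refl
  ∑-unfoldˡ f (suc n) = trans (+-congʳ (∑-unfoldˡ f n)) (+-assoc _ _ _)

  ∑-head : ∀ {f} n → (∀ k → f (suc k) ≈ 0#) → ∑ f n ≈ f 0
  ∑-head         zero    _    = refl
  ∑-head {f} (suc n) tail≈0 = begin
    ∑ f (suc n)                        ≈⟨ ∑-unfoldˡ f n ⟩
    f 0 + ∑ (λ k → f (suc k)) n        ≈⟨ +-congˡ (∑-zero n (λ k _ → tail≈0 k)) ⟩
    f 0 + 0#                           ≈⟨ +-identityʳ _ ⟩
    f 0                                ∎

  ∑-reverse : ∀ f n → ∑ f n ≈ ∑ (λ k → f (n ∸ k)) n
  ∑-reverse f zero    = refl
  ∑-reverse f (suc n) = begin
    ∑ f n + f (suc n)                    ≈⟨ +-congʳ (∑-reverse f n) ⟩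
    ∑ (λ k → f (n ∸ k)) n + f (suc n)    ≈⟨ +-comm _ _ ⟩
    f (suc n) + ∑ (λ k → f (n ∸ k)) n    ≈⟨ ∑-unfoldˡ (λ k → f (suc n ∸ k)) n ⟨
    ∑ (λ k → f (suc n ∸ k)) (suc n)      ∎

  ∑-triangle : ∀ (T : ℕ → ℕ → Carrier) n →
               ∑ (λ k → ∑ (λ a → T a k) k) n ≈ ∑ (λ a → ∑ (λ b → T a (a ℕ.+ b)) (n ∸ a)) n
  ∑-triangle T zero    = refl
  ∑-triangle T (suc n) = begin
    ∑ (λ k → ∑ (λ a → T a k) k) n + (∑ (λ a → T a (suc n)) n + T (suc n) (suc n))
      ≈⟨ +-assoc _ _ _ ⟨
    (∑ (λ k → ∑ (λ a → T a k) k) n + ∑ (λ a → T a (suc n)) n) + T (suc n) (suc n)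
      ≈⟨ +-congʳ (+-congʳ (∑-triangle T n)) ⟩
    (∑ rows n + ∑ (λ a → T a (suc n)) n) + T (suc n) (suc n)
      ≈⟨ +-congʳ (∑-distrib-+ rows (λ a → T a (suc n)) n) ⟨
    ∑ (λ a → rows a + T a (suc n)) n + T (suc n) (suc n)
      ≈⟨ +-cong (∑-cong≤ n extend) (reflexive (≡.cong (T (suc n)) (≡.sym (ℕ.+-identityʳ (suc n))))) ⟩
    ∑ (λ a → ∑ (λ b → T a (a ℕ.+ b)) (suc n ∸ a)) n + T (suc n) (suc n ℕ.+ 0)
      ≡⟨ ≡.cong (λ m → ∑ (λ a → ∑ (λ b → T a (a ℕ.+ b)) (suc n ∸ a)) n + ∑ (λ b → T (suc n) (suc n ℕ.+ b)) m)
                (≡.sym (ℕ.n∸n≡0 n)) ⟩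
    ∑ (λ a → ∑ (λ b → T a (a ℕ.+ b)) (suc n ∸ a)) (suc n) ∎
    where
    rows : ℕ → Carrier
    rows a = ∑ (λ b → T a (a ℕ.+ b)) (n ∸ a)
    extend : ∀ a → a ≤ n → rows a + T a (suc n) ≈ ∑ (λ b → T a (a ℕ.+ b)) (suc n ∸ a)
    extend a a≤n rewrite ℕ.+-∸-assoc 1 a≤n =
      +-congˡ (reflexive (≡.cong (T a) (≡.trans (≡.sym (ℕ.m+[n∸m]≡n (ℕ.m≤n⇒m≤1+n a≤n)))
                                               (≡.cong (a ℕ.+_) (ℕ.+-∸-assoc 1 a≤n)))))

module IntegerRingSolver {c ℓ} (R : CommutativeRing c ℓ) where

  open import Level using (0ℓ)
  open import Algebra.Bundles using (RawRing)
  open import Algebra.Solver.Ring.AlmostCommutativeRing using (fromCommutativeRing; _-Raw-AlmostCommutative⟶_)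
  open import Data.Maybe using (Maybe; nothing; just)
  open import Data.Nat as ℕ using (ℕ; zero; suc; _∸_)
  open import Data.Product using (_×_; _,_)
  open import Relation.Binary.PropositionalEquality as ≡ using (_≡_)
  open import Relation.Nullary using (yes)
  import Algebra.Solver.Ring as Solver
  open CommutativeRing R
  open import Algebra.Properties.Ring ring using (-‿distribˡ-*; -‿distribʳ-*; -‿involutive; -‿anti-homo-+; ⁻¹-anti-homo‿-; -0#≈0#)
  open import Algebra.Properties.Semiring.Mult.TCOptimised semiring using (×-homo-+; ×1-homo-*; 1+×)
    renaming (_×_ to _·_)
  open import Algebra.Properties.CommutativeSemigroup +-commutativeSemigroup using (interchange)
  open import Relation.Binary.Reasoning.Setoid setoid

  -- Integer coefficients are pairs (a , b) standing for a − b, kept with a = 0 or b = 0 so that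
  -- _≡_ decides their equality: the solver needs this to discard vanishing terms.
  canonical : ℕ × ℕ → ℕ × ℕ
  canonical (a , b) = (a ∸ b , b ∸ a)

  ℤ-rawRing : RawRing 0ℓ 0ℓ
  ℤ-rawRing = record
    { Carrier = ℕ × ℕ
    ; _≈_ = _≡_
    ; _+_ = λ { (a , b) (c , d) → canonical (a ℕ.+ c , b ℕ.+ d) }
    ; _*_ = λ { (a , b) (c , d) → canonical (a ℕ.* c ℕ.+ b ℕ.* d , a ℕ.* d ℕ.+ b ℕ.* c) }
    ; -_  = λ { (a , b) → (b , a) }
    ; 0#  = (0 , 0)
    ; 1#  = (1 , 0)
    }

  -- Chosen so that ⟦ 0 , 0 ⟧ and ⟦ 1 , 0 ⟧ are 0# and 1# on the nose, as solved goals contain them.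
  ⟦_⟧ : ℕ × ℕ → Carrier
  ⟦ a     , zero  ⟧ = a · 1#
  ⟦ zero  , suc b ⟧ = - (suc b · 1#)
  ⟦ suc a , suc b ⟧ = ⟦ a , b ⟧

  +-−-cancelˡ : ∀ o x y → (o + x) - (o + y) ≈ x - y
  +-−-cancelˡ o x y = begin
    (o + x) + - (o + y)      ≈⟨ +-congˡ (-‿anti-homo-+ o y) ⟩
    (o + x) + (- y + - o)    ≈⟨ +-congˡ (+-comm _ _) ⟩
    (o + x) + (- o + - y)    ≈⟨ interchange o x (- o) (- y) ⟩
    (o - o) + (x - y)        ≈⟨ +-congʳ (-‿inverseʳ o) ⟩
    0# + (x - y)             ≈⟨ +-identityˡ _ ⟩
    x - y                    ∎

  −-distrib-+ : ∀ x y z w → (x + z) - (y + w) ≈ (x - y) + (z - w)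
  −-distrib-+ x y z w = begin
    (x + z) + - (y + w)      ≈⟨ +-congˡ (-‿anti-homo-+ y w) ⟩
    (x + z) + (- w + - y)    ≈⟨ +-congˡ (+-comm _ _) ⟩
    (x + z) + (- y + - w)    ≈⟨ interchange x z (- y) (- w) ⟩
    (x - y) + (z - w)        ∎

  −-*-expand : ∀ x y z w → (x - y) * (z - w) ≈ (x * z + y * w) - (x * w + y * z)
  −-*-expand x y z w = begin
    (x - y) * (z - w)                                   ≈⟨ distribʳ _ _ _ ⟩
    x * (z - w) + - y * (z - w)                         ≈⟨ +-cong (distribˡ _ _ _) (distribˡ _ _ _) ⟩
    (x * z + x * - w) + (- y * z + - y * - w)           ≈⟨ +-cong (+-congˡ (sym (-‿distribʳ-* x w)))
                                                                  (+-cong (sym (-‿distribˡ-* y z)) minus-minus) ⟩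
    (x * z + - (x * w)) + (- (y * z) + y * w)           ≈⟨ +-congˡ (+-comm _ _) ⟩
    (x * z + - (x * w)) + (y * w + - (y * z))           ≈⟨ interchange _ _ _ _ ⟩
    (x * z + y * w) + (- (x * w) + - (y * z))           ≈⟨ +-congˡ (trans (+-comm _ _) (sym (-‿anti-homo-+ _ _))) ⟩
    (x * z + y * w) - (x * w + y * z)                   ∎
    where
    minus-minus : - y * - w ≈ y * w
    minus-minus = trans (sym (-‿distribˡ-* y (- w))) (trans (-‿cong (sym (-‿distribʳ-* y w))) (-‿involutive _))

  ⟦⟧-difference : ∀ a b → ⟦ a , b ⟧ ≈ a · 1# - b · 1#
  ⟦⟧-difference a       zero    = sym (trans (+-congˡ -0#≈0#) (+-identityʳ _))
  ⟦⟧-difference zero    (suc b) = sym (+-identityˡ _)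
  ⟦⟧-difference (suc a) (suc b) = trans (⟦⟧-difference a b)
    (sym (trans (+-cong (1+× a 1#) (-‿cong (1+× b 1#))) (+-−-cancelˡ 1# (a · 1#) (b · 1#))))

  ⟦canonical⟧ : ∀ a b → ⟦ canonical (a , b) ⟧ ≡ ⟦ a , b ⟧
  ⟦canonical⟧ zero    zero    = ≡.refl
  ⟦canonical⟧ zero    (suc b) = ≡.refl
  ⟦canonical⟧ (suc a) zero    = ≡.refl
  ⟦canonical⟧ (suc a) (suc b) = ⟦canonical⟧ a b

  homomorphism : ℤ-rawRing -Raw-AlmostCommutative⟶ fromCommutativeRing R
  homomorphism = record
    { ⟦_⟧    = ⟦_⟧
    ; +-homo = λ { (a , b) (c , d) → begin
        ⟦ canonical (a ℕ.+ c , b ℕ.+ d) ⟧              ≡⟨ ⟦canonical⟧ (a ℕ.+ c) (b ℕ.+ d) ⟩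
        ⟦ a ℕ.+ c , b ℕ.+ d ⟧                          ≈⟨ ⟦⟧-difference (a ℕ.+ c) (b ℕ.+ d) ⟩
        (a ℕ.+ c) · 1# - (b ℕ.+ d) · 1#                ≈⟨ +-cong (×-homo-+ 1# a c) (-‿cong (×-homo-+ 1# b d)) ⟩
        (a · 1# + c · 1#) - (b · 1# + d · 1#)          ≈⟨ −-distrib-+ _ _ _ _ ⟩
        (a · 1# - b · 1#) + (c · 1# - d · 1#)          ≈⟨ +-cong (⟦⟧-difference a b) (⟦⟧-difference c d) ⟨
        ⟦ a , b ⟧ + ⟦ c , d ⟧                          ∎ }
    ; *-homo = λ { (a , b) (c , d) → begin
        ⟦ canonical (a ℕ.* c ℕ.+ b ℕ.* d , a ℕ.* d ℕ.+ b ℕ.* c) ⟧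
          ≡⟨ ⟦canonical⟧ (a ℕ.* c ℕ.+ b ℕ.* d) (a ℕ.* d ℕ.+ b ℕ.* c) ⟩
        ⟦ a ℕ.* c ℕ.+ b ℕ.* d , a ℕ.* d ℕ.+ b ℕ.* c ⟧
          ≈⟨ ⟦⟧-difference (a ℕ.* c ℕ.+ b ℕ.* d) (a ℕ.* d ℕ.+ b ℕ.* c) ⟩
        (a ℕ.* c ℕ.+ b ℕ.* d) · 1# - (a ℕ.* d ℕ.+ b ℕ.* c) · 1#
          ≈⟨ +-cong (trans (×-homo-+ 1# (a ℕ.* c) (b ℕ.* d)) (+-cong (×1-homo-* a c) (×1-homo-* b d)))
                    (-‿cong (trans (×-homo-+ 1# (a ℕ.* d) (b ℕ.* c)) (+-cong (×1-homo-* a d) (×1-homo-* b c)))) ⟩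
        (a · 1# * (c · 1#) + b · 1# * (d · 1#)) - (a · 1# * (d · 1#) + b · 1# * (c · 1#))
          ≈⟨ −-*-expand _ _ _ _ ⟨
        (a · 1# - b · 1#) * (c · 1# - d · 1#)
          ≈⟨ *-cong (⟦⟧-difference a b) (⟦⟧-difference c d) ⟨
        ⟦ a , b ⟧ * ⟦ c , d ⟧ ∎ }
    ; -‿homo = λ { (a , b) → begin
        ⟦ b , a ⟧                 ≈⟨ ⟦⟧-difference b a ⟩
        b · 1# - a · 1#           ≈⟨ ⁻¹-anti-homo‿- (a · 1#) (b · 1#) ⟨
        - (a · 1# - b · 1#)       ≈⟨ -‿cong (⟦⟧-difference a b) ⟨
        - ⟦ a , b ⟧               ∎ }
    ; 0-homo = refl
    ; 1-homo = refl
    }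

  coefficient≟ : ∀ p q → Maybe (⟦ p ⟧ ≈ ⟦ q ⟧)
  coefficient≟ (a , b) (c , d) with a ℕ.≟ c | b ℕ.≟ d
  ... | yes ≡.refl | yes ≡.refl = just refl
  ... | _          | _          = nothing

  open Solver ℤ-rawRing (fromCommutativeRing R) homomorphism coefficient≟ public
    using (Polynomial; solve; _:=_; _:+_; _:*_; _:-_; con)

  :0 :1 : ∀ {n} → Polynomial n
  :0 = con (0 , 0)
  :1 = con (1 , 0)

module Derivations {c ℓ} (R : CommutativeRing c ℓ) where

  open import Level using (_⊔_)
  open CommutativeRing R
  open import Relation.Binary.Reasoning.Setoid setoid
  open import Algebra.Properties.Ring ring using (x+x≈x⇒x≈0; +-inverseʳ-unique)

  record IsDerivation (δ : Carrier → Carrier) : Set (c ⊔ ℓ) where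
    field
      cong   : ∀ {x y} → x ≈ y → δ x ≈ δ y
      +-homo : ∀ x y → δ (x + y) ≈ δ x + δ y
      leibniz : ∀ x y → δ (x * y) ≈ δ x * y + x * δ y

    0#↦0# : δ 0# ≈ 0#
    0#↦0# = x+x≈x⇒x≈0 (δ 0#) (trans (sym (+-homo 0# 0#)) (cong (+-identityʳ 0#)))

    1#↦0# : δ 1# ≈ 0#
    1#↦0# = x+x≈x⇒x≈0 (δ 1#) (begin
      δ 1# + δ 1#            ≈⟨ +-cong (*-identityʳ (δ 1#)) (*-identityˡ (δ 1#)) ⟨
      δ 1# * 1# + 1# * δ 1#  ≈⟨ leibniz 1# 1# ⟨
      δ (1# * 1#)            ≈⟨ cong (*-identityʳ 1#) ⟩
      δ 1#                   ∎)

    -‿homo : ∀ x → δ (- x) ≈ - δ x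
    -‿homo x = +-inverseʳ-unique (δ x) (δ (- x))
                 (trans (sym (+-homo x (- x))) (trans (cong (-‿inverseʳ x)) 0#↦0#))

    −-homo : ∀ x y → δ (x - y) ≈ δ x - δ y
    −-homo x y = trans (+-homo x (- y)) (+-congˡ (-‿homo y))

    leibniz-constantˡ : ∀ x y → δ x ≈ 0# → δ (x * y) ≈ x * δ y
    leibniz-constantˡ x y δx≈0 = begin
      δ (x * y)              ≈⟨ leibniz x y ⟩
      δ x * y + x * δ y      ≈⟨ +-congʳ (trans (*-congʳ δx≈0) (zeroˡ y)) ⟩
      0# + x * δ y           ≈⟨ +-identityˡ _ ⟩
      x * δ y                ∎

module PowerSeries {c ℓ} (R : CommutativeRing c ℓ) where

  open import Data.Nat as ℕ using (ℕ; zero; suc; _∸_; _≤_)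
  open import Data.Nat.Properties as ℕ using ()
  open import Data.Product using (_,_)
  open import Relation.Binary.PropositionalEquality as ≡ using (_≡_)
  open import Algebra.Structures using (IsCommutativeRing)
  open CommutativeRing R
  open import Algebra.Properties.Ring ring using (-0#≈0#)
  open import Algebra.Properties.Semiring.Mult semiring using (_×_; ×-congʳ; ×-homo-+; ×-assoc-*; ×-comm-*; ×-idem)
  open import Algebra.Properties.CommutativeMonoid.Mult +-commutativeMonoid using (×-distrib-+)
  open import Relation.Binary.Reasoning.Setoid setoid
  open FiniteSums R
  open Derivations R

  PS : Set c
  PS = ℕ → Carrier

  infix  4 _≋_
  infixl 6 _⊕_
  infixl 7 _⊛_

  _≋_ : PS → PS → Set ℓ
  f ≋ g = ∀ n → f n ≈ g n

  _⊕_ : PS → PS → PS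
  (f ⊕ g) n = f n + g n

  ⊖_ : PS → PS
  (⊖ f) n = - f n

  𝟘 : PS
  𝟘 _ = 0#

  ι : Carrier → PS
  ι x zero    = x
  ι x (suc n) = 0#

  𝟙 : PS
  𝟙 = ι 1#

  _⊛_ : PS → PS → PS
  (f ⊛ g) n = ∑ (λ k → f k * g (n ∸ k)) n

  ⊛-cong : ∀ {f f′ g g′} → f ≋ f′ → g ≋ g′ → f ⊛ g ≋ f′ ⊛ g′
  ⊛-cong f≋f′ g≋g′ n = ∑-cong n (λ k → *-cong (f≋f′ k) (g≋g′ (n ∸ k)))

  ⊛-comm : ∀ f g → f ⊛ g ≋ g ⊛ f
  ⊛-comm f g n = begin
    ∑ (λ k → f k * g (n ∸ k)) n               ≈⟨ ∑-reverse _ n ⟩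
    ∑ (λ k → f (n ∸ k) * g (n ∸ (n ∸ k))) n   ≈⟨ ∑-cong≤ n swap ⟩
    ∑ (λ k → g k * f (n ∸ k)) n               ∎
    where
    swap : ∀ k → k ≤ n → f (n ∸ k) * g (n ∸ (n ∸ k)) ≈ g k * f (n ∸ k)
    swap k k≤n = trans (*-comm _ _) (*-congʳ (reflexive (≡.cong g (ℕ.m∸[m∸n]≡n k≤n))))

  ⊛-assoc : ∀ f g h → (f ⊛ g) ⊛ h ≋ f ⊛ (g ⊛ h)
  ⊛-assoc f g h n = begin
    ∑ (λ k → ∑ (λ a → f a * g (k ∸ a)) k * h (n ∸ k)) n
      ≈⟨ ∑-cong n (λ k → *-distribʳ-∑ _ _ k) ⟩
    ∑ (λ k → ∑ (λ a → f a * g (k ∸ a) * h (n ∸ k)) k) n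
      ≈⟨ ∑-triangle (λ a k → f a * g (k ∸ a) * h (n ∸ k)) n ⟩
    ∑ (λ a → ∑ (λ b → f a * g ((a ℕ.+ b) ∸ a) * h (n ∸ (a ℕ.+ b))) (n ∸ a)) n
      ≈⟨ ∑-cong n (λ a → ∑-cong (n ∸ a) (λ b → trans (*-assoc _ _ _) (*-congˡ (reindex a b)))) ⟩
    ∑ (λ a → ∑ (λ b → f a * (g b * h ((n ∸ a) ∸ b))) (n ∸ a)) n
      ≈⟨ ∑-cong n (λ a → *-distribˡ-∑ _ _ (n ∸ a)) ⟨
    ∑ (λ a → f a * ∑ (λ b → g b * h ((n ∸ a) ∸ b)) (n ∸ a)) n ∎
    where
    reindex : ∀ a b → g ((a ℕ.+ b) ∸ a) * h (n ∸ (a ℕ.+ b)) ≈ g b * h ((n ∸ a) ∸ b)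
    reindex a b = *-cong (reflexive (≡.cong g (ℕ.m+n∸m≡n a b))) (reflexive (≡.cong h (≡.sym (ℕ.∸-+-assoc n a b))))

  ⊛-distribˡ : ∀ f g h → f ⊛ (g ⊕ h) ≋ f ⊛ g ⊕ f ⊛ h
  ⊛-distribˡ f g h n = trans (∑-cong n (λ k → distribˡ _ _ _)) (∑-distrib-+ _ _ n)

  ⊛-distribʳ : ∀ f g h → (g ⊕ h) ⊛ f ≋ g ⊛ f ⊕ h ⊛ f
  ⊛-distribʳ f g h n = trans (∑-cong n (λ k → distribʳ _ _ _)) (∑-distrib-+ _ _ n)

  ι-⊛ : ∀ x f → ι x ⊛ f ≋ λ n → x * f n
  ι-⊛ x f n = ∑-head n (λ k → zeroˡ _)

  ⊛-identityˡ : ∀ f → 𝟙 ⊛ f ≋ f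
  ⊛-identityˡ f n = trans (ι-⊛ 1# f n) (*-identityˡ _)

  ⊛-identityʳ : ∀ f → f ⊛ 𝟙 ≋ f
  ⊛-identityʳ f n = trans (⊛-comm f 𝟙 n) (⊛-identityˡ f n)

  ⊕-⊛-isCommutativeRing : IsCommutativeRing _≋_ _⊕_ _⊛_ ⊖_ 𝟘 𝟙
  ⊕-⊛-isCommutativeRing = record
    { isRing = record
      { +-isAbelianGroup = record
        { isGroup = record
          { isMonoid = record
            { isSemigroup = record
              { isMagma = record
                { isEquivalence = record
                  { refl  = λ n → refl
                  ; sym   = λ f≋g n → sym (f≋g n)
                  ; trans = λ f≋g g≋h n → trans (f≋g n) (g≋h n)
                  }
                ; ∙-cong = λ f≋f′ g≋g′ n → +-cong (f≋f′ n) (g≋g′ n)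
                }
              ; assoc = λ f g h n → +-assoc _ _ _
              }
            ; identity = (λ f n → +-identityˡ _) , (λ f n → +-identityʳ _)
            }
          ; inverse = (λ f n → -‿inverseˡ _) , (λ f n → -‿inverseʳ _)
          ; ⁻¹-cong = λ f≋g n → -‿cong (f≋g n)
          }
        ; comm = λ f g n → +-comm _ _
        }
      ; *-cong     = ⊛-cong
      ; *-assoc    = ⊛-assoc
      ; *-identity = ⊛-identityˡ , ⊛-identityʳ
      ; distrib    = ⊛-distribˡ , ⊛-distribʳ
      }
    ; *-comm = ⊛-comm
    }

  ⊕-⊛-commutativeRing : CommutativeRing c ℓ
  ⊕-⊛-commutativeRing = record { isCommutativeRing = ⊕-⊛-isCommutativeRing }

  ι-cong : ∀ {x y} → x ≈ y → ι x ≋ ι y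
  ι-cong x≈y zero    = x≈y
  ι-cong x≈y (suc n) = refl

  ι-homo-0# : ι 0# ≋ 𝟘
  ι-homo-0# zero    = refl
  ι-homo-0# (suc n) = refl

  ι-homo-+ : ∀ x y → ι (x + y) ≋ ι x ⊕ ι y
  ι-homo-+ x y zero    = refl
  ι-homo-+ x y (suc n) = sym (+-identityˡ _)

  ι--‿homo : ∀ x → ι (- x) ≋ ⊖ ι x
  ι--‿homo x zero    = refl
  ι--‿homo x (suc n) = sym -0#≈0#

  ι-homo-* : ∀ x y → ι (x * y) ≋ ι x ⊛ ι y
  ι-homo-* x y n = sym (trans (ι-⊛ x (ι y) n) (scaled n))
    where
    scaled : ∀ n → x * ι y n ≈ ι (x * y) n
    scaled zero    = refl
    scaled (suc n) = zeroʳ _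

  X : PS
  X zero          = 0#
  X (suc zero)    = 1#
  X (suc (suc n)) = 0#

  X-⊛-zero : ∀ f → (X ⊛ f) 0 ≈ 0#
  X-⊛-zero f = zeroˡ (f 0)

  X-⊛-suc : ∀ f n → (X ⊛ f) (suc n) ≈ f n
  X-⊛-suc f n = begin
    ∑ (λ k → X k * f (suc n ∸ k)) (suc n)                 ≈⟨ ∑-unfoldˡ _ n ⟩
    0# * f (suc n) + ∑ (λ k → X (suc k) * f (n ∸ k)) n    ≈⟨ +-cong (zeroˡ _) (∑-head n (λ k → zeroˡ _)) ⟩
    0# + 1# * f n                                         ≈⟨ +-identityˡ _ ⟩
    1# * f n                                              ≈⟨ *-identityˡ _ ⟩
    f n                                                   ∎

  D : PS → PS
  D f n = suc n × f (suc n)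

  ×-distrib-∑ : ∀ m f n → m × ∑ f n ≈ ∑ (λ k → m × f k) n
  ×-distrib-∑ m f zero    = refl
  ×-distrib-∑ m f (suc n) = trans (×-distrib-+ (∑ f n) (f (suc n)) m) (+-congʳ (×-distrib-∑ m f n))

  D-leibniz : ∀ f g → D (f ⊛ g) ≋ D f ⊛ g ⊕ f ⊛ D g
  D-leibniz f g n = begin
    suc n × ∑ T (suc n)                                       ≈⟨ ×-distrib-∑ (suc n) T (suc n) ⟩
    ∑ (λ k → suc n × T k) (suc n)                             ≈⟨ ∑-cong≤ (suc n) split ⟩
    ∑ (λ k → k × T k + (suc n ∸ k) × T k) (suc n)             ≈⟨ ∑-distrib-+ _ _ (suc n) ⟩
    ∑ (λ k → k × T k) (suc n) + ∑ (λ k → (suc n ∸ k) × T k) (suc n)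
                                                              ≈⟨ +-cong differentiate-f differentiate-g ⟩
    (D f ⊛ g) n + (f ⊛ D g) n                                 ∎
    where
    T : ℕ → Carrier
    T k = f k * g (suc n ∸ k)
    split : ∀ k → k ≤ suc n → suc n × T k ≈ k × T k + (suc n ∸ k) × T k
    split k k≤ = trans (reflexive (≡.cong (_× T k) (≡.sym (ℕ.m+[n∸m]≡n k≤)))) (×-homo-+ (T k) k (suc n ∸ k))
    differentiate-f : ∑ (λ k → k × T k) (suc n) ≈ (D f ⊛ g) n
    differentiate-f = begin
      ∑ (λ k → k × T k) (suc n)                               ≈⟨ ∑-unfoldˡ _ n ⟩
      0# + ∑ (λ k → suc k × T (suc k)) n                      ≈⟨ +-identityˡ _ ⟩
      ∑ (λ k → suc k × T (suc k)) n                           ≈⟨ ∑-cong n (λ k → sym (×-assoc-* (suc k) _ _)) ⟩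
      (D f ⊛ g) n                                             ∎
    differentiate-g : ∑ (λ k → (suc n ∸ k) × T k) (suc n) ≈ (f ⊛ D g) n
    differentiate-g = begin
      ∑ (λ k → (suc n ∸ k) × T k) n + (n ∸ n) × T (suc n)     ≈⟨ +-congˡ (reflexive (≡.cong (_× T (suc n)) (ℕ.n∸n≡0 n))) ⟩
      ∑ (λ k → (suc n ∸ k) × T k) n + 0#                      ≈⟨ +-identityʳ _ ⟩
      ∑ (λ k → (suc n ∸ k) × T k) n                           ≈⟨ ∑-cong≤ n (λ k k≤n → lemma k k≤n) ⟩
      (f ⊛ D g) n                                             ∎
      where
      lemma : ∀ k → k ≤ n → (suc n ∸ k) × T k ≈ f k * D g (n ∸ k)
      lemma k k≤n rewrite ℕ.+-∸-assoc 1 k≤n = sym (×-comm-* (suc (n ∸ k)) (f k) _)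

  D-ι : ∀ x → D (ι x) ≋ 𝟘
  D-ι x n = ×-idem (+-identityʳ 0#) (suc n)

  D-X : D X ≋ 𝟙
  D-X zero    = +-identityʳ 1#
  D-X (suc n) = ×-idem (+-identityʳ 0#) (suc (suc n))

  module PSDerivations = Derivations ⊕-⊛-commutativeRing

  D-isDerivation : PSDerivations.IsDerivation D
  D-isDerivation = record
    { cong    = λ f≋g n → ×-congʳ (suc n) (f≋g (suc n))
    ; +-homo  = λ f g n → ×-distrib-+ (f (suc n)) (g (suc n)) (suc n)
    ; leibniz = D-leibniz
    }

  lift : (Carrier → Carrier) → PS → PS
  lift δ f n = δ (f n)

  lift-isDerivation : ∀ {δ} → IsDerivation δ → PSDerivations.IsDerivation (lift δ)
  lift-isDerivation {δ} δ-isDerivation = record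
    { cong    = λ f≋g n → cong (f≋g n)
    ; +-homo  = λ f g n → +-homo _ _
    ; leibniz = λ f g n → trans (∑-homo _ n) (trans (∑-cong n (λ k → leibniz _ _)) (∑-distrib-+ _ _ n))
    }
    where
    open IsDerivation δ-isDerivation
    ∑-homo : ∀ f n → δ (∑ f n) ≈ ∑ (λ k → δ (f k)) n
    ∑-homo f zero    = refl
    ∑-homo f (suc n) = trans (+-homo _ _) (+-congʳ (∑-homo f n))

  lift-ι : ∀ {δ} → IsDerivation δ → ∀ x → lift δ (ι x) ≋ ι (δ x)
  lift-ι δ-isDerivation x zero    = refl
  lift-ι δ-isDerivation x (suc n) = IsDerivation.0#↦0# δ-isDerivation

  lift-X : ∀ {δ} → IsDerivation δ → lift δ X ≋ 𝟘
  lift-X δ-isDerivation zero          = IsDerivation.0#↦0# δ-isDerivation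
  lift-X δ-isDerivation (suc zero)    = IsDerivation.1#↦0# δ-isDerivation
  lift-X δ-isDerivation (suc (suc n)) = IsDerivation.0#↦0# δ-isDerivation

  module Sums = FiniteSums ⊕-⊛-commutativeRing

  ∑-coefficient : ∀ F n k → Sums.∑ F n k ≈ ∑ (λ a → F a k) n
  ∑-coefficient F zero    k = refl
  ∑-coefficient F (suc n) k = +-congʳ (∑-coefficient F n k)

  vanishing : (∀ n x → suc n × x ≈ 0# → x ≈ 0#) → ∀ f → f 0 ≈ 0# → (∀ n → f n ≈ 0# → D f n ≈ 0#) → f ≋ 𝟘
  vanishing torsionFree f f₀≈0 step zero    = f₀≈0
  vanishing torsionFree f f₀≈0 step (suc n) = torsionFree n (f (suc n)) (step n (vanishing torsionFree f f₀≈0 step n))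

module ResidualEquation {c ℓ} (R : CommutativeRing c ℓ) where

  open CommutativeRing R
  open Derivations R
  open IntegerRingSolver R using (solve; _:=_; _:+_; _:*_; _:-_; :0; :1)

  module _ {∂ δ : Carrier → Carrier} (∂-isDerivation : IsDerivation ∂) (δ-isDerivation : IsDerivation δ)
           {F E u v : Carrier}
           (F-ode : ∂ F ≈ 1# + (u + v) * F + (u * v) * δ F)
           (E-ode : ∂ E ≈ (v - u) * E) (δE≈0 : δ E ≈ 0#)
           (∂u≈0 : ∂ u ≈ 0#) (∂v≈0 : ∂ v ≈ 0#) (δu≈1 : δ u ≈ 1#) (δv≈1 : δ v ≈ 1#) where

    private
      module ∂ = IsDerivation ∂-isDerivation
      module δ = IsDerivation δ-isDerivation

    residual : Carrier
    residual = F * (v - u * E) - (E - 1#)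

    ∂-residual : ∂ residual ≈ (1# + (u + v) * F + (u * v) * δ F) * (v - u * E)
                               + F * (0# - (0# * E + u * ((v - u) * E))) - ((v - u) * E - 0#)
    ∂-residual = trans (∂.−-homo _ _) (+-cong ∂[F*Den] (-‿cong (trans (∂.−-homo E 1#) (+-cong E-ode (-‿cong ∂.1#↦0#)))))
      where
      ∂[F*Den] : ∂ (F * (v - u * E)) ≈ (1# + (u + v) * F + (u * v) * δ F) * (v - u * E)
                                        + F * (0# - (0# * E + u * ((v - u) * E)))
      ∂[F*Den] = trans (∂.leibniz F _) (+-cong (*-congʳ F-ode) (*-congˡ
                   (trans (∂.−-homo v (u * E)) (+-cong ∂v≈0 (-‿cong (trans (∂.leibniz u E) (+-cong (*-congʳ ∂u≈0) (*-congˡ E-ode))))))))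

    δ-residual : δ residual ≈ δ F * (v - u * E) + F * (1# - (1# * E + u * 0#)) - (0# - 0#)
    δ-residual = trans (δ.−-homo _ _) (+-cong δ[F*Den] (-‿cong (trans (δ.−-homo E 1#) (+-cong δE≈0 (-‿cong δ.1#↦0#)))))
      where
      δ[F*Den] : δ (F * (v - u * E)) ≈ δ F * (v - u * E) + F * (1# - (1# * E + u * 0#))
      δ[F*Den] = trans (δ.leibniz F _) (+-congˡ (*-congˡ
                   (trans (δ.−-homo v (u * E)) (+-cong δv≈1 (-‿cong (trans (δ.leibniz u E) (+-cong (*-congʳ δu≈1) (*-congˡ δE≈0))))))))

    residual-ode : ∂ residual ≈ v * residual + (u * v) * δ residual
    residual-ode = trans ∂-residual (trans (solve 5
      (λ F δF E u v → (:1 :+ (u :+ v) :* F :+ (u :* v) :* δF) :* (v :- u :* E)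
                        :+ F :* (:0 :- (:0 :* E :+ u :* ((v :- u) :* E))) :- ((v :- u) :* E :- :0)
                    := v :* (F :* (v :- u :* E) :- (E :- :1))
                        :+ (u :* v) :* (δF :* (v :- u :* E) :+ F :* (:1 :- (:1 :* E :+ u :* :0)) :- (:0 :- :0)))
      refl F (δ F) E u v) (+-congˡ (*-congˡ (sym δ-residual))))

module ListSums {c ℓ} (R : CommutativeRing c ℓ) where

  open import Data.Bool using (Bool; true; false; if_then_else_; not; _∧_; _∨_)
  open import Data.List using (List; []; _∷_; _++_; map; concatMap; upTo; filter)
  open import Data.List.Properties using (map-applyUpTo)
  open import Relation.Nullary using (does)
  open import Relation.Unary using (Pred; Decidable)
  open import Data.List.Membership.Propositional using (_∈_)
  open import Data.List.Relation.Unary.Any using (here; there)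
  open import Data.Nat using (ℕ; suc)
  open import Relation.Binary.PropositionalEquality as ≡ using (_≡_)
  open CommutativeRing R
  open import Algebra.Properties.CommutativeSemigroup +-commutativeSemigroup using (interchange)

  ind : Bool → Carrier → Carrier
  ind b x = if b then x else 0#

  ind-cong : ∀ b {x y} → x ≈ y → ind b x ≈ ind b y
  ind-cong true  x≈y = x≈y
  ind-cong false x≈y = refl

  ind-∧ : ∀ b₁ b₂ x → ind (b₁ ∧ b₂) x ≈ ind b₁ (ind b₂ x)
  ind-∧ true  b₂ x = refl
  ind-∧ false b₂ x = refl

  ind-∧-swap : ∀ b₁ b₂ x → ind (b₁ ∧ b₂) x ≈ ind b₂ (ind b₁ x)
  ind-∧-swap true  true  x = refl
  ind-∧-swap true  false x = refl
  ind-∧-swap false true  x = refl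
  ind-∧-swap false false x = refl

  ind-not-∨ : ∀ b₁ b₂ x → ind (not (b₁ ∨ b₂)) x ≈ ind (not b₁) (ind (not b₂) x)
  ind-not-∨ true  b₂ x = refl
  ind-not-∨ false b₂ x = refl

  ind-*ˡ : ∀ b y x → ind b (y * x) ≈ y * ind b x
  ind-*ˡ true  y x = refl
  ind-*ˡ false y x = sym (zeroʳ y)

  ind-+ : ∀ b x y → ind b (x + y) ≈ ind b x + ind b y
  ind-+ true  x y = refl
  ind-+ false x y = sym (+-identityˡ 0#)

  private
    variable
      A B : Set

  sumOver : List A → (A → Carrier) → Carrier
  sumOver []       f = 0#
  sumOver (x ∷ xs) f = f x + sumOver xs f

  syntax sumOver xs (λ x → e) = ∑[ x ∈ xs ] e

  ∑∈-cong : ∀ xs {f g : A → Carrier} → (∀ x → f x ≈ g x) → ∑[ x ∈ xs ] f x ≈ ∑[ x ∈ xs ] g x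
  ∑∈-cong []       f≈g = refl
  ∑∈-cong (x ∷ xs) f≈g = +-cong (f≈g x) (∑∈-cong xs f≈g)

  ∑∈-cong-∈ : ∀ xs {f g : A → Carrier} → (∀ x → x ∈ xs → f x ≈ g x) → ∑[ x ∈ xs ] f x ≈ ∑[ x ∈ xs ] g x
  ∑∈-cong-∈ []       f≈g = refl
  ∑∈-cong-∈ (x ∷ xs) f≈g = +-cong (f≈g x (here ≡.refl)) (∑∈-cong-∈ xs (λ y y∈xs → f≈g y (there y∈xs)))

  ∑∈-zero : ∀ xs {f : A → Carrier} → (∀ x → f x ≈ 0#) → ∑[ x ∈ xs ] f x ≈ 0#
  ∑∈-zero []       f≈0 = refl
  ∑∈-zero (x ∷ xs) f≈0 = trans (+-cong (f≈0 x) (∑∈-zero xs f≈0)) (+-identityˡ 0#)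

  ∑∈-distrib-+ : ∀ xs (f g : A → Carrier) → ∑[ x ∈ xs ] (f x + g x) ≈ ∑[ x ∈ xs ] f x + ∑[ x ∈ xs ] g x
  ∑∈-distrib-+ []       f g = sym (+-identityˡ 0#)
  ∑∈-distrib-+ (x ∷ xs) f g = trans (+-congˡ (∑∈-distrib-+ xs f g)) (interchange _ _ _ _)

  *-distribˡ-∑∈ : ∀ xs y (f : A → Carrier) → y * ∑[ x ∈ xs ] f x ≈ ∑[ x ∈ xs ] (y * f x)
  *-distribˡ-∑∈ []       y f = zeroʳ y
  *-distribˡ-∑∈ (x ∷ xs) y f = trans (distribˡ y _ _) (+-congˡ (*-distribˡ-∑∈ xs y f))

  ∑∈-++ : ∀ xs ys (f : A → Carrier) → ∑[ x ∈ xs ++ ys ] f x ≈ ∑[ x ∈ xs ] f x + ∑[ x ∈ ys ] f x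
  ∑∈-++ []       ys f = sym (+-identityˡ _)
  ∑∈-++ (x ∷ xs) ys f = trans (+-congˡ (∑∈-++ xs ys f)) (sym (+-assoc _ _ _))

  ∑∈-ind : ∀ xs b (f : A → Carrier) → ∑[ x ∈ xs ] ind b (f x) ≈ ind b (∑[ x ∈ xs ] f x)
  ∑∈-ind xs true  f = refl
  ∑∈-ind xs false f = ∑∈-zero xs (λ x → refl)

  ∑∈-if : ∀ b xs (f : A → Carrier) → ∑[ x ∈ (if b then xs else []) ] f x ≈ ind b (∑[ x ∈ xs ] f x)
  ∑∈-if true  xs f = refl
  ∑∈-if false xs f = refl

  ∑∈-filter : ∀ {p} {P : Pred A p} (P? : Decidable P) xs (f : A → Carrier) →
              ∑[ x ∈ xs ] ind (does (P? x)) (f x) ≈ ∑[ x ∈ filter P? xs ] f x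
  ∑∈-filter P? []       f = refl
  ∑∈-filter P? (x ∷ xs) f with does (P? x)
  ... | true  = +-congˡ (∑∈-filter P? xs f)
  ... | false = trans (+-identityˡ _) (∑∈-filter P? xs f)

  ∑∈-map : ∀ (g : A → B) xs (f : B → Carrier) → ∑[ y ∈ map g xs ] f y ≈ ∑[ x ∈ xs ] f (g x)
  ∑∈-map g []       f = refl
  ∑∈-map g (x ∷ xs) f = +-congˡ (∑∈-map g xs f)

  ∑∈-concatMap : ∀ (g : A → List B) xs (f : B → Carrier) → ∑[ y ∈ concatMap g xs ] f y ≈ ∑[ x ∈ xs ] ∑[ y ∈ g x ] f y
  ∑∈-concatMap g []       f = refl
  ∑∈-concatMap g (x ∷ xs) f = trans (∑∈-++ (g x) (concatMap g xs) f) (+-congˡ (∑∈-concatMap g xs f))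

  ∑∈-swap : ∀ xs ys (f : A → B → Carrier) → ∑[ x ∈ xs ] ∑[ y ∈ ys ] f x y ≈ ∑[ y ∈ ys ] ∑[ x ∈ xs ] f x y
  ∑∈-swap []       ys f = sym (∑∈-zero ys (λ y → refl))
  ∑∈-swap (x ∷ xs) ys f = trans (+-congˡ (∑∈-swap xs ys f)) (sym (∑∈-distrib-+ ys (f x) (λ y → ∑[ x ∈ xs ] f x y)))

  ∑∈-upTo-suc : ∀ n (f : ℕ → Carrier) → ∑[ p ∈ upTo (suc n) ] f p ≈ f 0 + ∑[ p ∈ upTo n ] f (suc p)
  ∑∈-upTo-suc n f = +-congˡ (trans (reflexive (≡.cong (λ ps → ∑[ p ∈ ps ] f p) (≡.sym (map-applyUpTo (λ p → p) suc n))))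
                                   (∑∈-map suc (upTo n) f))

module DistinctWords {c ℓ} (R : CommutativeRing c ℓ) where

  open import Defs using (allLists; distinct)
  open import Data.Bool using (Bool; not; _∧_; _∨_)
  open import Data.Bool.ListAction using (any)
  open import Data.Fin using (Fin; zero; suc; _≟_)
  open import Data.List using (List; []; _∷_; map; length; upTo; allFin; filter)
  open import Data.List.Properties using (map-tabulate; filter-notAll)
  open import Data.List.Membership.Propositional using (_∈_)
  open import Data.List.Relation.Unary.Any as Any using ()
  open import Data.Nat as ℕ using (ℕ; zero; suc; _<_)
  open import Data.Nat.Properties as ℕ using ()
  open import Relation.Binary.PropositionalEquality as ≡ using (_≡_)
  open import Relation.Nullary using (does; ¬?)
  open CommutativeRing R hiding (zero)
  open import Relation.Binary.Reasoning.Setoid setoid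
  open ListSums R
  open import Algebra.Properties.CommutativeSemigroup +-commutativeSemigroup using (x∙yz≈y∙xz)

  private
    variable
      A : Set
      m : ℕ

  ∑-allLists-suc : ∀ k (xs : List A) (f : List A → Carrier) →
                   ∑[ w ∈ allLists (suc k) xs ] f w ≈ ∑[ a ∈ xs ] ∑[ w ∈ allLists k xs ] f (a ∷ w)
  ∑-allLists-suc k xs f = trans (∑∈-concatMap (λ a → map (a ∷_) (allLists k xs)) xs f)
                                (∑∈-cong xs (λ a → ∑∈-map (a ∷_) (allLists k xs) f))

  ∑-allLists-cong : ∀ k (xs : List A) {f g : List A → Carrier} → (∀ w → length w ≡ k → f w ≈ g w) →
                    ∑[ w ∈ allLists k xs ] f w ≈ ∑[ w ∈ allLists k xs ] g w
  ∑-allLists-cong zero    xs f≈g = +-congʳ (f≈g [] ≡.refl)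
  ∑-allLists-cong (suc k) xs {f} {g} f≈g = begin
    ∑[ w ∈ allLists (suc k) xs ] f w                 ≈⟨ ∑-allLists-suc k xs f ⟩
    ∑[ a ∈ xs ] ∑[ w ∈ allLists k xs ] f (a ∷ w)     ≈⟨ ∑∈-cong xs (λ a → ∑-allLists-cong k xs (λ w ∣w∣≡k → f≈g (a ∷ w) (≡.cong suc ∣w∣≡k))) ⟩
    ∑[ a ∈ xs ] ∑[ w ∈ allLists k xs ] g (a ∷ w)     ≈⟨ ∑-allLists-suc k xs g ⟨
    ∑[ w ∈ allLists (suc k) xs ] g w                 ∎

  sumDistinct : ℕ → List (Fin m) → (List (Fin m) → Carrier) → Carrier
  sumDistinct k xs f = ∑[ w ∈ allLists k xs ] ind (distinct w) (f w)

  _==_ : Fin m → Fin m → Bool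
  a == b = does (a ≟ b)

  ∑-avoiding : ∀ k (ys : List (Fin m)) a (f : List (Fin m) → Carrier) →
               ∑[ w ∈ allLists k ys ] ind (not (any (a ==_) w)) (f w) ≈ ∑[ w ∈ allLists k (filter (λ b → ¬? (a ≟ b)) ys) ] f w
  ∑-avoiding zero    ys a f = refl
  ∑-avoiding (suc k) ys a f = begin
    ∑[ w ∈ allLists (suc k) ys ] ind (not (any (a ==_) w)) (f w)
      ≈⟨ ∑-allLists-suc k ys _ ⟩
    ∑[ b ∈ ys ] ∑[ w ∈ allLists k ys ] ind (not ((a == b) ∨ any (a ==_) w)) (f (b ∷ w))
      ≈⟨ ∑∈-cong ys (λ b → begin
           ∑[ w ∈ allLists k ys ] ind (not ((a == b) ∨ any (a ==_) w)) (f (b ∷ w))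
             ≈⟨ ∑∈-cong (allLists k ys) (λ w → ind-not-∨ (a == b) (any (a ==_) w) (f (b ∷ w))) ⟩
           ∑[ w ∈ allLists k ys ] ind (not (a == b)) (ind (not (any (a ==_) w)) (f (b ∷ w)))
             ≈⟨ ∑∈-ind (allLists k ys) (not (a == b)) _ ⟩
           ind (not (a == b)) (∑[ w ∈ allLists k ys ] ind (not (any (a ==_) w)) (f (b ∷ w)))
             ≈⟨ ind-cong (not (a == b)) (∑-avoiding k ys a (λ w → f (b ∷ w))) ⟩
           ind (not (a == b)) (∑[ w ∈ allLists k ys′ ] f (b ∷ w)) ∎) ⟩
    ∑[ b ∈ ys ] ind (not (a == b)) (∑[ w ∈ allLists k ys′ ] f (b ∷ w))
      ≈⟨ ∑∈-filter (λ b → ¬? (a ≟ b)) ys _ ⟩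
    ∑[ b ∈ ys′ ] ∑[ w ∈ allLists k ys′ ] f (b ∷ w)
      ≈⟨ ∑-allLists-suc k ys′ f ⟨
    ∑[ w ∈ allLists (suc k) ys′ ] f w ∎
    where
    ys′ : List (Fin _)
    ys′ = filter (λ b → ¬? (a ≟ b)) ys

  sumDistinct-tooLong : ∀ k (ys : List (Fin m)) f → length ys < k → sumDistinct k ys f ≈ 0#
  sumDistinct-tooLong (suc k) ys f ∣ys∣<1+k = begin
    ∑[ w ∈ allLists (suc k) ys ] ind (distinct w) (f w)
      ≈⟨ ∑-allLists-suc k ys _ ⟩
    ∑[ a ∈ ys ] ∑[ w ∈ allLists k ys ] ind (not (any (a ==_) w) ∧ distinct w) (f (a ∷ w))
      ≈⟨ ∑∈-cong-∈ ys (λ a a∈ys → begin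
           ∑[ w ∈ allLists k ys ] ind (not (any (a ==_) w) ∧ distinct w) (f (a ∷ w))
             ≈⟨ ∑∈-cong (allLists k ys) (λ w → ind-∧ (not (any (a ==_) w)) (distinct w) (f (a ∷ w))) ⟩
           ∑[ w ∈ allLists k ys ] ind (not (any (a ==_) w)) (ind (distinct w) (f (a ∷ w)))
             ≈⟨ ∑-avoiding k ys a _ ⟩
           sumDistinct k (filter (λ b → ¬? (a ≟ b)) ys) (λ w → f (a ∷ w))
             ≈⟨ sumDistinct-tooLong k _ _ (ℕ.<-≤-trans (shorter a∈ys) (ℕ.≤-pred ∣ys∣<1+k)) ⟩
           0# ∎) ⟩
    ∑[ a ∈ ys ] 0#
      ≈⟨ ∑∈-zero ys (λ a → refl) ⟩
    0# ∎
    where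
    shorter : ∀ {a : Fin _} → a ∈ ys → length (filter (λ b → ¬? (a ≟ b)) ys) < length ys
    shorter {a} a∈ys = filter-notAll (λ b → ¬? (a ≟ b)) ys (Any.map (λ a≡b a≢b → a≢b a≡b) a∈ys)

  allFin-suc : ∀ n → allFin (suc n) ≡ zero ∷ map suc (allFin n)
  allFin-suc n = ≡.cong (zero ∷_) (≡.sym (map-tabulate (λ i → i) suc))

  insertAt : ℕ → A → List A → List A
  insertAt zero    z w       = z ∷ w
  insertAt (suc p) z []      = z ∷ []
  insertAt (suc p) z (a ∷ w) = a ∷ insertAt p z w

  any-map-suc : ∀ (b : Fin m) w → any (suc b ==_) (map suc w) ≡ any (b ==_) w
  any-map-suc b []      = ≡.refl
  any-map-suc b (c ∷ w) = ≡.cong ((b == c) ∨_) (any-map-suc b w)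

  any-insertAt-zero : ∀ (b : Fin m) p w → any (suc b ==_) (insertAt p zero (map suc w)) ≡ any (b ==_) w
  any-insertAt-zero b zero    w       = any-map-suc b w
  any-insertAt-zero b (suc p) []      = ≡.refl
  any-insertAt-zero b (suc p) (c ∷ w) = ≡.cong ((b == c) ∨_) (any-insertAt-zero b p w)

  distinct-map-suc : (w : List (Fin m)) → distinct (map suc w) ≡ distinct w
  distinct-map-suc []      = ≡.refl
  distinct-map-suc (a ∷ w) = ≡.cong₂ (λ x y → not x ∧ y) (any-map-suc a w) (distinct-map-suc w)

  ∑-avoiding-zero : ∀ k (ys : List (Fin m)) (f : List (Fin (suc m)) → Carrier) →
                    ∑[ w ∈ allLists k (zero ∷ map suc ys) ] ind (not (any (zero ==_) w)) (f w)
                    ≈ ∑[ w ∈ allLists k ys ] f (map suc w)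
  ∑-avoiding-zero zero    ys f = refl
  ∑-avoiding-zero (suc k) ys f = begin
    ∑[ w ∈ allLists (suc k) Z ] F w
      ≈⟨ ∑-allLists-suc k Z F ⟩
    ∑[ w ∈ allLists k Z ] F (zero ∷ w) + ∑[ a ∈ map suc ys ] ∑[ w ∈ allLists k Z ] F (a ∷ w)
      ≈⟨ +-cong (∑∈-zero (allLists k Z) (λ w → refl)) (∑∈-map suc ys _) ⟩
    0# + ∑[ b ∈ ys ] ∑[ w ∈ allLists k Z ] ind (not (any (zero ==_) w)) (f (suc b ∷ w))
      ≈⟨ +-identityˡ _ ⟩
    ∑[ b ∈ ys ] ∑[ w ∈ allLists k Z ] ind (not (any (zero ==_) w)) (f (suc b ∷ w))
      ≈⟨ ∑∈-cong ys (λ b → ∑-avoiding-zero k ys (λ w → f (suc b ∷ w))) ⟩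
    ∑[ b ∈ ys ] ∑[ w ∈ allLists k ys ] f (map suc (b ∷ w))
      ≈⟨ ∑-allLists-suc k ys (λ w → f (map suc w)) ⟨
    ∑[ w ∈ allLists (suc k) ys ] f (map suc w) ∎
    where
    Z = zero ∷ map suc ys
    F : List (Fin (suc _)) → Carrier
    F w = ind (not (any (zero ==_) w)) (f w)

  sumDistinct-insert-zero : ∀ k (ys : List (Fin m)) (f : List (Fin (suc m)) → Carrier) →
    sumDistinct (suc k) (zero ∷ map suc ys) f
    ≈ sumDistinct (suc k) ys (λ w → f (map suc w))
      + ∑[ p ∈ upTo (suc k) ] sumDistinct k ys (λ w → f (insertAt p zero (map suc w)))

  ∑-nonzero-heads : ∀ k (ys : List (Fin m)) (f : List (Fin (suc m)) → Carrier) →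
    ∑[ b ∈ ys ] sumDistinct k (zero ∷ map suc ys) (λ w → ind (not (any (suc b ==_) w)) (f (suc b ∷ w)))
    ≈ sumDistinct (suc k) ys (λ w → f (map suc w))
      + ∑[ p ∈ upTo k ] sumDistinct k ys (λ w → f (insertAt (suc p) zero (map suc w)))

  sumDistinct-insert-zero k ys f = begin
    ∑[ w ∈ allLists (suc k) Z ] ind (distinct w) (f w)
      ≈⟨ ∑-allLists-suc k Z _ ⟩
    head-zero + ∑[ a ∈ map suc ys ] ∑[ w ∈ allLists k Z ] ind (distinct (a ∷ w)) (f (a ∷ w))
      ≈⟨ +-cong head-zero≈ (trans (∑∈-map suc ys _) (∑∈-cong ys (λ b → ∑∈-cong (allLists k Z) (λ w →
           ind-∧-swap (not (any (suc b ==_) w)) (distinct w) (f (suc b ∷ w)))))) ⟩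
    g 0 + ∑[ b ∈ ys ] sumDistinct k Z (λ w → ind (not (any (suc b ==_) w)) (f (suc b ∷ w)))
      ≈⟨ +-congˡ (∑-nonzero-heads k ys f) ⟩
    g 0 + (sumDistinct (suc k) ys (λ w → f (map suc w)) + ∑[ p ∈ upTo k ] g (suc p))
      ≈⟨ x∙yz≈y∙xz _ _ _ ⟩
    sumDistinct (suc k) ys (λ w → f (map suc w)) + (g 0 + ∑[ p ∈ upTo k ] g (suc p))
      ≈⟨ +-congˡ (∑∈-upTo-suc k g) ⟨
    sumDistinct (suc k) ys (λ w → f (map suc w)) + ∑[ p ∈ upTo (suc k) ] g p ∎
    where
    Z = zero ∷ map suc ys
    g : ℕ → Carrier
    g p = sumDistinct k ys (λ w → f (insertAt p zero (map suc w)))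
    head-zero = ∑[ w ∈ allLists k Z ] ind (distinct (zero ∷ w)) (f (zero ∷ w))
    head-zero≈ : head-zero ≈ g 0
    head-zero≈ = begin
      head-zero
        ≈⟨ ∑∈-cong (allLists k Z) (λ w → ind-∧ (not (any (zero ==_) w)) (distinct w) (f (zero ∷ w))) ⟩
      ∑[ w ∈ allLists k Z ] ind (not (any (zero ==_) w)) (ind (distinct w) (f (zero ∷ w)))
        ≈⟨ ∑-avoiding-zero k ys (λ w → ind (distinct w) (f (zero ∷ w))) ⟩
      ∑[ w ∈ allLists k ys ] ind (distinct (map suc w)) (f (zero ∷ map suc w))
        ≈⟨ ∑∈-cong (allLists k ys) (λ w → reflexive (≡.cong (λ b → ind b (f (zero ∷ map suc w))) (distinct-map-suc w))) ⟩
      g 0 ∎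

  ∑-nonzero-heads zero    ys f = trans (sym (∑-allLists-suc 0 ys (λ w → ind (distinct w) (f (map suc w))))) (sym (+-identityʳ _))
  ∑-nonzero-heads (suc k) ys f = begin
    ∑[ b ∈ ys ] sumDistinct (suc k) Z (f′ b)
      ≈⟨ ∑∈-cong ys (λ b → sumDistinct-insert-zero k ys (f′ b)) ⟩
    ∑[ b ∈ ys ] (sumDistinct (suc k) ys (λ w → f′ b (map suc w))
                 + ∑[ p ∈ upTo (suc k) ] sumDistinct k ys (λ w → f′ b (insertAt p zero (map suc w))))
      ≈⟨ ∑∈-cong ys (λ b → +-cong (∑∈-cong (allLists (suc k) ys) (λ w → tail-avoids b w))
                                  (∑∈-cong (upTo (suc k)) (λ p → ∑∈-cong (allLists k ys) (λ w → tail-avoids-inserted b p w)))) ⟩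
    ∑[ b ∈ ys ] (U b + ∑[ p ∈ upTo (suc k) ] V b p)
      ≈⟨ ∑∈-distrib-+ ys U (λ b → ∑[ p ∈ upTo (suc k) ] V b p) ⟩
    ∑[ b ∈ ys ] U b + ∑[ b ∈ ys ] ∑[ p ∈ upTo (suc k) ] V b p
      ≈⟨ +-cong (sym (∑-allLists-suc (suc k) ys _))
                (trans (∑∈-swap ys (upTo (suc k)) V) (∑∈-cong (upTo (suc k)) (λ p → sym (∑-allLists-suc k ys _)))) ⟩
    sumDistinct (suc (suc k)) ys (λ w → f (map suc w))
      + ∑[ p ∈ upTo (suc k) ] sumDistinct (suc k) ys (λ w → f (insertAt (suc p) zero (map suc w))) ∎
    where
    Z = zero ∷ map suc ys
    f′ : Fin _ → List (Fin (suc _)) → Carrier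
    f′ b w = ind (not (any (suc b ==_) w)) (f (suc b ∷ w))
    U : Fin _ → Carrier
    U b = ∑[ w ∈ allLists (suc k) ys ] ind (distinct (b ∷ w)) (f (map suc (b ∷ w)))
    V : Fin _ → ℕ → Carrier
    V b p = ∑[ w ∈ allLists k ys ] ind (distinct (b ∷ w)) (f (insertAt (suc p) zero (map suc (b ∷ w))))
    tail-avoids : ∀ b w → ind (distinct w) (f′ b (map suc w)) ≈ ind (distinct (b ∷ w)) (f (map suc (b ∷ w)))
    tail-avoids b w = trans (reflexive (≡.cong (λ x → ind (distinct w) (ind (not x) (f (suc b ∷ map suc w)))) (any-map-suc b w)))
                            (sym (ind-∧-swap (not (any (b ==_) w)) (distinct w) _))
    tail-avoids-inserted : ∀ b p w → ind (distinct w) (f′ b (insertAt p zero (map suc w)))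
                                     ≈ ind (distinct (b ∷ w)) (f (insertAt (suc p) zero (map suc (b ∷ w))))
    tail-avoids-inserted b p w =
      trans (reflexive (≡.cong (λ x → ind (distinct w) (ind (not x) (f (suc b ∷ insertAt p zero (map suc w))))) (any-insertAt-zero b p w)))
            (sym (ind-∧-swap (not (any (b ==_) w)) (distinct w) _))

module DescentWeights {c ℓ} (R : CommutativeRing c ℓ) where

  open import Defs using (allLists; distinct)
  open import Data.Bool using (true; false; if_then_else_)
  open import Data.Fin using (Fin; zero; suc; toℕ)
  open import Data.List using (List; []; _∷_; map; length; upTo; allFin)
  open import Data.List.Properties using (length-tabulate)
  open import Data.Nat as ℕ using (ℕ; zero; suc; _<ᵇ_; s≤s)
  open import Data.Nat.Properties as ℕ using ()
  open import Relation.Binary.PropositionalEquality as ≡ using (_≡_)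
  open CommutativeRing R hiding (zero)
  open import Relation.Binary.Reasoning.Setoid setoid
  open Derivations R
  open ListSums R
  open DistinctWords R
  open IntegerRingSolver R using (solve; _:=_; _:+_; _:*_; :0; :1)

  private
    variable
      m : ℕ

  module Weights {δ : Carrier → Carrier} (δ-isDerivation : IsDerivation δ)
                 (u v : Carrier) (δu≈1 : δ u ≈ 1#) (δv≈1 : δ v ≈ 1#) where

    private
      module δ = IsDerivation δ-isDerivation

    descentWeight : Fin m → Fin m → Carrier
    descentWeight a b = if toℕ b <ᵇ toℕ a then u else v

    weight : List (Fin m) → Carrier
    weight []          = 1#
    weight (a ∷ [])    = 1#
    weight (a ∷ b ∷ w) = descentWeight a b * weight (b ∷ w)

    weight-map-suc : (w : List (Fin m)) → weight (map suc w) ≡ weight w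
    weight-map-suc []          = ≡.refl
    weight-map-suc (a ∷ [])    = ≡.refl
    weight-map-suc (a ∷ b ∷ w) = ≡.cong (descentWeight a b *_) (weight-map-suc (b ∷ w))

    δ-descentWeight : (a b : Fin m) → δ (descentWeight a b) ≈ 1#
    δ-descentWeight a b with toℕ b <ᵇ toℕ a
    ... | true  = δu≈1
    ... | false = δv≈1

    -- Inserting 0 right after a letter a turns the factor for the pair (a , b) into
    -- u · v; since δ of each factor is 1, summing over the positions after a is a Leibniz rule.
    ∑-insert-zero-after : ∀ (a : Fin m) w →
      ∑[ p ∈ upTo (suc (length w)) ] weight (suc a ∷ insertAt p zero (map suc w))
      ≈ u * weight (a ∷ w) + (u * v) * δ (weight (a ∷ w))
    ∑-insert-zero-after a [] = begin
      u * 1# + 0#                      ≈⟨ solve 2 (λ u uv → u :* :1 :+ :0 := u :* :1 :+ uv :* :0) refl u (u * v) ⟩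
      u * 1# + (u * v) * 0#            ≈⟨ +-congˡ (*-congˡ δ.1#↦0#) ⟨
      u * 1# + (u * v) * δ 1#          ∎
    ∑-insert-zero-after a (b ∷ w) = begin
      ∑[ p ∈ upTo (suc (suc (length w))) ] weight (suc a ∷ insertAt p zero (map suc (b ∷ w)))
        ≈⟨ ∑∈-upTo-suc (suc (length w)) _ ⟩
      u * (v * weight (suc b ∷ map suc w)) + ∑[ p ∈ upTo (suc (length w)) ] (g * I p)
        ≈⟨ +-cong (reflexive (≡.cong (λ x → u * (v * x)) (weight-map-suc (b ∷ w)))) (sym (*-distribˡ-∑∈ (upTo (suc (length w))) g I)) ⟩
      u * (v * W) + g * ∑[ p ∈ upTo (suc (length w)) ] I p
        ≈⟨ +-congˡ (*-congˡ (∑-insert-zero-after b w)) ⟩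
      u * (v * W) + g * (u * W + (u * v) * δ W)
        ≈⟨ solve 5 (λ u v g W δW → u :* (v :* W) :+ g :* (u :* W :+ (u :* v) :* δW)
                                   := u :* (g :* W) :+ (u :* v) :* (:1 :* W :+ g :* δW)) refl u v g W (δ W) ⟩
      u * (g * W) + (u * v) * (1# * W + g * δ W)
        ≈⟨ +-congˡ (*-congˡ (sym (trans (δ.leibniz g W) (+-congʳ (*-congʳ (δ-descentWeight a b)))))) ⟩
      u * (g * W) + (u * v) * δ (g * W) ∎
      where
      g W : Carrier
      g = descentWeight a b
      W = weight (b ∷ w)
      I : ℕ → Carrier
      I p = weight (suc b ∷ insertAt p zero (map suc w))

    ∑-insert-zero : ∀ n (w : List (Fin m)) → length w ≡ suc n →
      ∑[ p ∈ upTo (suc (suc n)) ] weight (insertAt p zero (map suc w))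
      ≈ (u + v) * weight w + (u * v) * δ (weight w)
    ∑-insert-zero n (a ∷ w) ≡.refl = begin
      ∑[ p ∈ upTo (suc (suc (length w))) ] weight (insertAt p zero (map suc (a ∷ w)))
        ≈⟨ ∑∈-upTo-suc (suc (length w)) _ ⟩
      v * weight (suc a ∷ map suc w) + ∑[ p ∈ upTo (suc (length w)) ] weight (suc a ∷ insertAt p zero (map suc w))
        ≈⟨ +-cong (reflexive (≡.cong (v *_) (weight-map-suc (a ∷ w)))) (∑-insert-zero-after a w) ⟩
      v * W + (u * W + (u * v) * δ W)
        ≈⟨ solve 4 (λ u v W δW → v :* W :+ (u :* W :+ (u :* v) :* δW) := (u :+ v) :* W :+ (u :* v) :* δW) refl u v W (δ W) ⟩
      (u + v) * W + (u * v) * δ W ∎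
      where
      W : Carrier
      W = weight (a ∷ w)

    δ-ind : ∀ b x → δ (ind b x) ≈ ind b (δ x)
    δ-ind true  x = refl
    δ-ind false x = δ.0#↦0#

    δ-∑∈ : ∀ {A : Set} (xs : List A) (f : A → Carrier) → δ (∑[ x ∈ xs ] f x) ≈ ∑[ x ∈ xs ] δ (f x)
    δ-∑∈ []       f = δ.0#↦0#
    δ-∑∈ (x ∷ xs) f = trans (δ.+-homo _ _) (+-congˡ (δ-∑∈ xs f))

    permutationSum : ℕ → Carrier
    permutationSum n = sumDistinct n (allFin n) weight

    permutationSum-recurrence : ∀ n →
      permutationSum (suc (suc n)) ≈ (u + v) * permutationSum (suc n) + (u * v) * δ (permutationSum (suc n))
    permutationSum-recurrence n = begin
      permutationSum (suc N)
        ≡⟨ ≡.cong (λ xs → sumDistinct (suc N) xs weight) (allFin-suc N) ⟩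
      sumDistinct (suc N) (zero ∷ map suc AF) weight
        ≈⟨ sumDistinct-insert-zero N AF weight ⟩
      sumDistinct (suc N) AF (λ w → weight (map suc w)) + ∑[ p ∈ upTo (suc N) ] ∑[ w ∈ allLists N AF ] ind (distinct w) (I p w)
        ≈⟨ +-congʳ (sumDistinct-tooLong (suc N) AF _ (s≤s (ℕ.≤-reflexive (length-tabulate (λ i → i))))) ⟩
      0# + ∑[ p ∈ upTo (suc N) ] ∑[ w ∈ allLists N AF ] ind (distinct w) (I p w)
        ≈⟨ +-identityˡ _ ⟩
      ∑[ p ∈ upTo (suc N) ] ∑[ w ∈ allLists N AF ] ind (distinct w) (I p w)
        ≈⟨ ∑∈-swap (upTo (suc N)) (allLists N AF) _ ⟩
      ∑[ w ∈ allLists N AF ] ∑[ p ∈ upTo (suc N) ] ind (distinct w) (I p w)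
        ≈⟨ ∑∈-cong (allLists N AF) (λ w → ∑∈-ind (upTo (suc N)) (distinct w) (λ p → I p w)) ⟩
      ∑[ w ∈ allLists N AF ] ind (distinct w) (∑[ p ∈ upTo (suc N) ] I p w)
        ≈⟨ ∑-allLists-cong N AF (λ w ∣w∣≡N → ind-cong (distinct w) (∑-insert-zero n w ∣w∣≡N)) ⟩
      ∑[ w ∈ allLists N AF ] ind (distinct w) ((u + v) * weight w + (u * v) * δ (weight w))
        ≈⟨ ∑∈-cong (allLists N AF) distribute ⟩
      ∑[ w ∈ allLists N AF ] ((u + v) * ind (distinct w) (weight w) + (u * v) * δ (ind (distinct w) (weight w)))
        ≈⟨ ∑∈-distrib-+ (allLists N AF) _ _ ⟩
      ∑[ w ∈ allLists N AF ] ((u + v) * ind (distinct w) (weight w))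
        + ∑[ w ∈ allLists N AF ] ((u * v) * δ (ind (distinct w) (weight w)))
        ≈⟨ +-cong (sym (*-distribˡ-∑∈ (allLists N AF) (u + v) _))
                  (trans (sym (*-distribˡ-∑∈ (allLists N AF) (u * v) _)) (*-congˡ (sym (δ-∑∈ (allLists N AF) _)))) ⟩
      (u + v) * permutationSum N + (u * v) * δ (permutationSum N) ∎
      where
      N : ℕ
      N = suc n
      AF : List (Fin N)
      AF = allFin N
      I : ℕ → List (Fin N) → Carrier
      I p w = weight (insertAt p zero (map suc w))
      distribute : ∀ w → ind (distinct w) ((u + v) * weight w + (u * v) * δ (weight w))
                         ≈ (u + v) * ind (distinct w) (weight w) + (u * v) * δ (ind (distinct w) (weight w))
      distribute w = trans (ind-+ (distinct w) _ _)
        (+-cong (ind-*ˡ (distinct w) (u + v) (weight w))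
                (trans (ind-*ˡ (distinct w) (u * v) (δ (weight w))) (*-congˡ (sym (δ-ind (distinct w) (weight w))))))

module RationalArithmetic where

  open import Data.Nat as ℕ using (ℕ; zero; suc; _!; NonZero)
  open import Data.Nat.Properties using (_!≢0)
  open import Data.Integer as ℤ using (+_)
  import Data.Integer.Properties as ℤ
  open import Data.Integer.Solver renaming (module +-*-Solver to ℤ-Solver)
  open import Data.Rational using (ℚ; 0ℚ; 1ℚ; _+_; _*_; _/_; fromℚᵘ)
  open import Data.Rational.Properties
    using (+-*-commutativeRing; toℚᵘ-injective; toℚᵘ-homo-+; toℚᵘ-homo-*; toℚᵘ-fromℚᵘ; fromℚᵘ-cong;
           *-identityˡ; *-identityʳ; *-assoc; *-comm; *-zeroʳ)
  open import Data.Rational.Unnormalised as ℚᵘ using (ℚᵘ; mkℚᵘ; *≡*)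
  import Data.Rational.Unnormalised.Properties as ℚᵘ
  open import Relation.Binary.PropositionalEquality
  open import Algebra.Properties.Semiring.Mult (CommutativeRing.semiring +-*-commutativeRing) using (_×_; ×-assoc-*)
  open import Defs using (invFact)
  open import Data.Rational.Solver renaming (module +-*-Solver to ℚ-Solver)

  fromℚᵘ-homo-+ : ∀ p q → fromℚᵘ (p ℚᵘ.+ q) ≡ fromℚᵘ p + fromℚᵘ q
  fromℚᵘ-homo-+ p q = toℚᵘ-injective (ℚᵘ.≃-trans (toℚᵘ-fromℚᵘ (p ℚᵘ.+ q))
    (ℚᵘ.≃-sym (ℚᵘ.≃-trans (toℚᵘ-homo-+ (fromℚᵘ p) (fromℚᵘ q)) (ℚᵘ.+-cong (toℚᵘ-fromℚᵘ p) (toℚᵘ-fromℚᵘ q)))))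

  fromℚᵘ-homo-* : ∀ p q → fromℚᵘ (p ℚᵘ.* q) ≡ fromℚᵘ p * fromℚᵘ q
  fromℚᵘ-homo-* p q = toℚᵘ-injective (ℚᵘ.≃-trans (toℚᵘ-fromℚᵘ (p ℚᵘ.* q))
    (ℚᵘ.≃-sym (ℚᵘ.≃-trans (toℚᵘ-homo-* (fromℚᵘ p) (fromℚᵘ q)) (ℚᵘ.*-cong (toℚᵘ-fromℚᵘ p) (toℚᵘ-fromℚᵘ q)))))

  /1-homo-+ : ∀ a b → + (a ℕ.+ b) / 1 ≡ + a / 1 + + b / 1
  /1-homo-+ a b = trans
    (fromℚᵘ-cong {mkℚᵘ (+ (a ℕ.+ b)) 0} {mkℚᵘ (+ a) 0 ℚᵘ.+ mkℚᵘ (+ b) 0} (*≡* (solve 2 (λ a b →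
      (a :+ b) :* (con (+ 1) :* con (+ 1)) := (a :* con (+ 1) :+ b :* con (+ 1)) :* con (+ 1)) refl (+ a) (+ b))))
    (fromℚᵘ-homo-+ (mkℚᵘ (+ a) 0) (mkℚᵘ (+ b) 0))
    where open ℤ-Solver

  n×1≡n/1 : ∀ n → n × 1ℚ ≡ + n / 1
  n×1≡n/1 zero    = refl
  n×1≡n/1 (suc n) = trans (cong (λ z → 1ℚ + z) (n×1≡n/1 n)) (sym (/1-homo-+ 1 n))

  n×x≡n/1*x : ∀ n x → n × x ≡ (+ n / 1) * x
  n×x≡n/1*x n x = begin
    n × x             ≡⟨ cong (n ×_) (*-identityˡ x) ⟨
    n × (1ℚ * x)      ≡⟨ ×-assoc-* n 1ℚ x ⟨
    (n × 1ℚ) * x      ≡⟨ cong (_* x) (n×1≡n/1 n) ⟩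
    (+ n / 1) * x     ∎
    where open ≡-Reasoning

  /1-homo-* : ∀ a b → (+ a / 1) * (+ b / 1) ≡ + (a ℕ.* b) / 1
  /1-homo-* a b = trans (sym (fromℚᵘ-homo-* (mkℚᵘ (+ a) 0) (mkℚᵘ (+ b) 0)))
    (fromℚᵘ-cong {mkℚᵘ (+ a) 0 ℚᵘ.* mkℚᵘ (+ b) 0} {mkℚᵘ (+ (a ℕ.* b)) 0} (*≡* (cong (ℤ._* + 1) (sym (ℤ.pos-* a b)))))

  1/n*n≡1 : ∀ n .{{_ : NonZero n}} → (+ 1 / n) * (+ n / 1) ≡ 1ℚ
  1/n*n≡1 (suc m) = trans (sym (fromℚᵘ-homo-* (mkℚᵘ (+ 1) m) (mkℚᵘ (+ suc m) 0)))
    (fromℚᵘ-cong {mkℚᵘ (+ 1) m ℚᵘ.* mkℚᵘ (+ suc m) 0} {mkℚᵘ (+ 1) 0} (*≡* (solve 1 (λ n → (con (+ 1) :* n) :* con (+ 1) := con (+ 1) :* (n :* con (+ 1))) refl (+ suc m))))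
    where open ℤ-Solver

  ×-invFact : ∀ n → suc n × invFact (suc n) ≡ invFact n
  ×-invFact n = begin
    suc n × invFact (suc n)                           ≡⟨ n×x≡n/1*x (suc n) _ ⟩
    a * invFact (suc n)                               ≡⟨ *-identityʳ _ ⟨
    a * invFact (suc n) * 1ℚ                          ≡⟨ cong (a * invFact (suc n) *_) (1/n*n≡1 (n !) {{n !≢0}}) ⟨
    a * invFact (suc n) * (invFact n * f)             ≡⟨ rearrange a (invFact (suc n)) (invFact n) f ⟩
    invFact n * (invFact (suc n) * (a * f))           ≡⟨ cong (λ z → invFact n * (invFact (suc n) * z)) (/1-homo-* (suc n) (n !)) ⟩
    invFact n * (invFact (suc n) * (+ (suc n !) / 1)) ≡⟨ cong (invFact n *_) (1/n*n≡1 (suc n !) {{suc n !≢0}}) ⟩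
    invFact n * 1ℚ                                    ≡⟨ *-identityʳ _ ⟩
    invFact n                                         ∎
    where
    open ≡-Reasoning
    a f : ℚ
    a = + suc n / 1
    f = + (n !) / 1
    rearrange : ∀ a x y f → a * x * (y * f) ≡ y * (x * (a * f))
    rearrange = solve 4 (λ a x y f → a :* x :* (y :* f) := y :* (x :* (a :* f))) refl
      where open ℚ-Solver

  1+n×x≡0⇒x≡0 : ∀ n x → suc n × x ≡ 0ℚ → x ≡ 0ℚ
  1+n×x≡0⇒x≡0 n x n×x≡0 = begin
    x                         ≡⟨ *-identityˡ x ⟨
    1ℚ * x                    ≡⟨ cong (_* x) (1/n*n≡1 (suc n)) ⟨
    (1/n * n̂) * x            ≡⟨ *-assoc 1/n n̂ x ⟩
    1/n * (n̂ * x)            ≡⟨ cong (1/n *_) (trans (sym (n×x≡n/1*x (suc n) x)) n×x≡0) ⟩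
    1/n * 0ℚ                  ≡⟨ *-zeroʳ 1/n ⟩
    0ℚ                        ∎
    where
    open ≡-Reasoning
    n̂ 1/n : ℚ
    n̂   = + suc n / 1
    1/n = + 1 / suc n

module SeriesRings where

  open import Defs
  open import Data.Nat using (zero; suc; _∸_)
  open import Data.Rational as ℚ using (ℚ; 0ℚ; 1ℚ)
  open import Data.Rational.Properties using (+-*-commutativeRing)
  open import Relation.Binary.PropositionalEquality as ≡ using (_≡_; refl; cong)
  open import Algebra.Properties.Semiring.Mult (CommutativeRing.semiring +-*-commutativeRing)
    using () renaming (_×_ to _×ℚ_)

  -- Poly2 is definitionally the carrier of ℚ⟦t,q⟧ = (ℚ⟦q⟧)⟦t⟧ (p i j is the coefficient of tⁱ qʲ),
  -- and FPS that of ℚ⟦t,q⟧⟦x⟧.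
  module Qq = PowerSeries +-*-commutativeRing

  ℚ⟦q⟧ : CommutativeRing _ _
  ℚ⟦q⟧ = Qq.⊕-⊛-commutativeRing

  module Qtq = PowerSeries ℚ⟦q⟧

  ℚ⟦t,q⟧ : CommutativeRing _ _
  ℚ⟦t,q⟧ = Qtq.⊕-⊛-commutativeRing

  module Qtqx = PowerSeries ℚ⟦t,q⟧

  ℚ⟦t,q⟧⟦x⟧ : CommutativeRing _ _
  ℚ⟦t,q⟧⟦x⟧ = Qtqx.⊕-⊛-commutativeRing

  module P = CommutativeRing ℚ⟦t,q⟧
  module S = CommutativeRing ℚ⟦t,q⟧⟦x⟧
  open import Algebra.Properties.Semiring.Mult P.semiring using () renaming (_×_ to _×ᴾ_)

  module ℚ-Sums = FiniteSums +-*-commutativeRing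

  sumTo≡∑ : ∀ f n → sumTo f n ≡ ℚ-Sums.∑ f n
  sumTo≡∑ f zero    = refl
  sumTo≡∑ f (suc n) = cong (ℚ._+ f (suc n)) (sumTo≡∑ f n)

  *P≗⊛ : ∀ p r i j → (p *P r) i j ≡ (p P.* r) i j
  *P≗⊛ p r i j = ≡.trans (sumTo≡∑ _ i) (≡.trans (ℚ-Sums.∑-cong i (λ a → sumTo≡∑ _ j))
                                                (≡.sym (Qq.∑-coefficient (λ a → p a Qq.⊛ r (i ∸ a)) i j)))

  *S≗⊛ : ∀ F H n i j → (F *S H) n i j ≡ (F S.* H) n i j
  *S≗⊛ F H n i j = ≡.trans (sumTo≡∑ _ n) (≡.trans (ℚ-Sums.∑-cong n (λ k → *P≗⊛ (F k) (H (n ∸ k)) i j))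
                     (≡.sym (≡.trans (Qtq.∑-coefficient (λ k → F k P.* H (n ∸ k)) n i j)
                                     (Qq.∑-coefficient (λ k → (F k P.* H (n ∸ k)) i) n j))))

  κ : ℚ → Poly2
  κ c = Qtq.ι (Qq.ι c)

  constP≈κ : ∀ c → constP c P.≈ κ c
  constP≈κ c zero    zero    = refl
  constP≈κ c zero    (suc j) = refl
  constP≈κ c (suc i) j       = refl

  κ-homo-0# : κ 0ℚ P.≈ P.0#
  κ-homo-0# zero    = Qq.ι-homo-0#
  κ-homo-0# (suc i) j = refl

  κ-homo-+ : ∀ a b → κ (a ℚ.+ b) P.≈ κ a P.+ κ b
  κ-homo-+ a b = P.trans (Qtq.ι-cong (Qq.ι-homo-+ a b)) (Qtq.ι-homo-+ (Qq.ι a) (Qq.ι b))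

  κ-*-coefficient : ∀ c p i j → (κ c P.* p) i j ≡ c ℚ.* p i j
  κ-*-coefficient c p i j = ≡.trans (Qtq.ι-⊛ (Qq.ι c) p i j) (Qq.ι-⊛ c (p i) j)

  scaleP≈κ* : ∀ c p → scaleP c p P.≈ κ c P.* p
  scaleP≈κ* c p i j = ≡.sym (κ-*-coefficient c p i j)

  ×ᴾ-κ : ∀ m c → m ×ᴾ κ c P.≈ κ (m ×ℚ c)
  ×ᴾ-κ zero    c = P.sym κ-homo-0#
  ×ᴾ-κ (suc m) c = P.trans (P.+-congˡ {κ c} (×ᴾ-κ m c)) (P.sym (κ-homo-+ c (m ×ℚ c)))

  ×ᴾ-coefficient : ∀ m p i j → (m ×ᴾ p) i j ≡ m ×ℚ p i j
  ×ᴾ-coefficient zero    p i j = refl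
  ×ᴾ-coefficient (suc m) p i j = cong (p i j ℚ.+_) (×ᴾ-coefficient m p i j)

  1+n×p≈0⇒p≈0 : ∀ n p → suc n ×ᴾ p P.≈ P.0# → p P.≈ P.0#
  1+n×p≈0⇒p≈0 n p n×p≈0 i j = RationalArithmetic.1+n×x≡0⇒x≡0 n (p i j) (≡.trans (≡.sym (×ᴾ-coefficient (suc n) p i j)) (n×p≈0 i j))

  open Derivations ℚ⟦t,q⟧ using (IsDerivation)

  ∂q : Poly2 → Poly2
  ∂q = Qtq.lift Qq.D

  ∂q-isDerivation : IsDerivation ∂q
  ∂q-isDerivation = Qtq.lift-isDerivation Qq.D-isDerivation

  module ∂q = IsDerivation ∂q-isDerivation

  ∂q-κ : ∀ c → ∂q (κ c) P.≈ P.0#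
  ∂q-κ c = P.trans (Qtq.lift-ι Qq.D-isDerivation (Qq.ι c)) (P.trans (Qtq.ι-cong (Qq.D-ι c)) (Qtq.ι-homo-0#))

  u v : Poly2
  u = tP +P qP
  v = constP 1ℚ +P qP

  t≈X : tP P.≈ Qtq.X
  t≈X zero          j       = refl
  t≈X (suc zero)    zero    = refl
  t≈X (suc zero)    (suc j) = refl
  t≈X (suc (suc i)) j       = refl

  q≈ιX : qP P.≈ Qtq.ι Qq.X
  q≈ιX zero    zero          = refl
  q≈ιX zero    (suc zero)    = refl
  q≈ιX zero    (suc (suc j)) = refl
  q≈ιX (suc i) j             = refl

  ∂q-t : ∂q tP P.≈ P.0#
  ∂q-t = P.trans (∂q.cong t≈X) (Qtq.lift-X Qq.D-isDerivation)

  ∂q-q : ∂q qP P.≈ P.1#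
  ∂q-q = P.trans (∂q.cong q≈ιX) (P.trans (Qtq.lift-ι Qq.D-isDerivation Qq.X) (Qtq.ι-cong Qq.D-X))

  ∂q-u : ∂q u P.≈ P.1#
  ∂q-u = P.trans (∂q.+-homo tP qP) (P.trans (P.+-cong ∂q-t ∂q-q) (P.+-identityˡ P.1#))

  ∂q-v : ∂q v P.≈ P.1#
  ∂q-v = P.trans (∂q.+-homo (constP 1ℚ) qP)
           (P.trans (P.+-cong (P.trans (∂q.cong (constP≈κ 1ℚ)) (∂q-κ 1ℚ)) ∂q-q) (P.+-identityˡ P.1#))

  1-t≈v-u : constP 1ℚ -P tP P.≈ v P.- u
  1-t≈v-u zero          zero          = refl
  1-t≈v-u zero          (suc zero)    = refl
  1-t≈v-u zero          (suc (suc j)) = refl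
  1-t≈v-u (suc zero)    zero          = refl
  1-t≈v-u (suc zero)    (suc j)       = refl
  1-t≈v-u (suc (suc i)) zero          = refl
  1-t≈v-u (suc (suc i)) (suc j)       = refl

module SegmentedPermutationCount where

  open import Defs
  open import Data.Bool using (Bool; true; false; if_then_else_; _∧_)
  open import Data.Fin using (Fin; toℕ)
  open import Data.List using (List; []; _∷_; map; length; allFin)
  open import Data.Nat as ℕ using (ℕ; zero; suc; _∸_; _≡ᵇ_; _<ᵇ_)
  open import Data.Integer using (+_)
  open import Data.Nat.Properties as ℕ using ()
  open import Data.Product using (_,_)
  open import Data.Rational as ℚ using (ℚ; 0ℚ; 1ℚ; _/_)
  open import Relation.Binary.PropositionalEquality as ≡ using (_≡_; refl)
  open SeriesRings
  open ListSums ℚ⟦t,q⟧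
  open DistinctWords ℚ⟦t,q⟧
  open DescentWeights ℚ⟦t,q⟧ using (module Weights)
  open Weights ∂q-isDerivation u v ∂q-u ∂q-v
  open IntegerRingSolver ℚ⟦t,q⟧ using (solve; _:=_; _:+_; _:*_; :0; :1)

  monomial : ℕ → ℕ → Poly2
  monomial d e i j = if (d ≡ᵇ i) ∧ (e ≡ᵇ j) then 1ℚ else 0ℚ

  monomial-t : ∀ d e → monomial (suc d) e P.≈ tP P.* monomial d e
  monomial-t d e = P.sym (P.trans (P.*-congʳ {monomial d e} t≈X) shift)
    where
    shift : Qtq.X P.* monomial d e P.≈ monomial (suc d) e
    shift zero    = Qtq.X-⊛-zero (monomial d e)
    shift (suc i) = Qtq.X-⊛-suc (monomial d e) i

  monomial-q : ∀ d e → monomial d (suc e) P.≈ qP P.* monomial d e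
  monomial-q d e = P.sym (P.trans (P.*-congʳ {monomial d e} q≈ιX) shift)
    where
    no-constant-term : ∀ b → 0ℚ ≡ (if b ∧ false then 1ℚ else 0ℚ)
    no-constant-term true  = refl
    no-constant-term false = refl
    shift : Qtq.ι Qq.X P.* monomial d e P.≈ monomial d (suc e)
    shift i zero    = ≡.trans (Qtq.ι-⊛ Qq.X (monomial d e) i zero)
                              (≡.trans (Qq.X-⊛-zero (monomial d e i)) (no-constant-term (d ≡ᵇ i)))
    shift i (suc j) = ≡.trans (Qtq.ι-⊛ Qq.X (monomial d e) i (suc j)) (Qq.X-⊛-suc (monomial d e i) j)

  monomial-0-0 : monomial 0 0 P.≈ P.1#
  monomial-0-0 zero    zero    = refl
  monomial-0-0 zero    (suc j) = refl
  monomial-0-0 (suc i) j       = refl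

  countᵇ≈∑ : ∀ {n} (σs : List (SegPerm n)) i j →
    + countᵇ (λ σ → (des σ ≡ᵇ i) ∧ (seg σ ≡ᵇ j)) σs / 1 ≡ (∑[ σ ∈ σs ] monomial (des σ) (seg σ)) i j
  countᵇ≈∑ []       i j = refl
  countᵇ≈∑ (σ ∷ σs) i j = ≡.trans (RationalArithmetic./1-homo-+ (if b then 1 else 0) (countᵇ (λ σ → (des σ ≡ᵇ i) ∧ (seg σ ≡ᵇ j)) σs))
                                  (≡.cong₂ ℚ._+_ (indicator b) (countᵇ≈∑ σs i j))
    where
    b : Bool
    b = (des σ ≡ᵇ i) ∧ (seg σ ≡ᵇ j)
    indicator : ∀ b → + (if b then 1 else 0) / 1 ≡ (if b then 1ℚ else 0ℚ)
    indicator true  = refl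
    indicator false = refl

  bars : ℕ → List (List Bool)
  bars k = allLists k (true ∷ false ∷ [])

  α≈∑-bars : ∀ n → α n P.≈ ∑[ w ∈ allLists n (allFin n) ] ind (distinct w) (∑[ bs ∈ bars (n ∸ 1) ] monomial (desW w bs) (segB bs))
  α≈∑-bars n = P.trans {α n} {∑[ σ ∈ SP n ] M σ} (countᵇ≈∑ (SP n))
    (P.trans (∑∈-concatMap withBars (allLists n (allFin n)) M) (∑∈-cong (allLists n (allFin n)) sumBars))
    where
    M : SegPerm n → Poly2
    M σ = monomial (des σ) (seg σ)
    withBars : List (Fin n) → List (SegPerm n)
    withBars w = if distinct w then map (w ,_) (bars (n ∸ 1)) else []
    sumBars : ∀ w → ∑[ σ ∈ withBars w ] M σ P.≈ ind (distinct w) (∑[ bs ∈ bars (n ∸ 1) ] monomial (desW w bs) (segB bs))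
    sumBars w = P.trans (∑∈-if (distinct w) (map (w ,_) (bars (n ∸ 1))) M)
                        (ind-cong (distinct w) (∑∈-map (w ,_) (bars (n ∸ 1)) M))

  open import Relation.Binary.Reasoning.Setoid P.setoid

  ∑-bars≈weight : ∀ {m} k (w : List (Fin m)) → length w ≡ suc k →
                  ∑[ bs ∈ bars k ] monomial (desW w bs) (segB bs) P.≈ weight w
  ∑-bars≈weight zero    (a ∷ [])    refl = P.trans (P.+-identityʳ _) monomial-0-0
  ∑-bars≈weight (suc k) (a ∷ b ∷ w) ∣w∣≡ = begin
    ∑[ bs ∈ bars (suc k) ] M (a ∷ b ∷ w) bs
      ≈⟨ ∑-allLists-suc k (true ∷ false ∷ []) (M (a ∷ b ∷ w)) ⟩
    ∑[ bs ∈ bars k ] M (a ∷ b ∷ w) (true ∷ bs) P.+ (∑[ bs ∈ bars k ] M (a ∷ b ∷ w) (false ∷ bs) P.+ P.0#)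
      ≈⟨ P.+-cong (∑∈-cong (bars k) (λ bs → monomial-q (desW (b ∷ w) bs) (segB bs)))
                  (P.+-congʳ (∑∈-cong (bars k) (λ bs → no-bar bs (toℕ b <ᵇ toℕ a)))) ⟩
    ∑[ bs ∈ bars k ] (qP P.* M (b ∷ w) bs) P.+ (∑[ bs ∈ bars k ] (factor P.* M (b ∷ w) bs) P.+ P.0#)
      ≈⟨ P.+-cong (P.sym (*-distribˡ-∑∈ (bars k) qP (M (b ∷ w)))) (P.+-congʳ (P.sym (*-distribˡ-∑∈ (bars k) factor (M (b ∷ w))))) ⟩
    qP P.* ∑[ bs ∈ bars k ] M (b ∷ w) bs P.+ (factor P.* ∑[ bs ∈ bars k ] M (b ∷ w) bs P.+ P.0#)
      ≈⟨ P.+-cong (P.*-congˡ {qP} IH) (P.+-congʳ (P.*-congˡ {factor} IH)) ⟩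
    qP P.* weight (b ∷ w) P.+ (factor P.* weight (b ∷ w) P.+ P.0#)
      ≈⟨ bar-or-not (toℕ b <ᵇ toℕ a) ⟩
    descentWeight a b P.* weight (b ∷ w) ∎
    where
    M : List (Fin _) → List Bool → Poly2
    M w bs = monomial (desW w bs) (segB bs)
    factor : Poly2
    factor = if toℕ b <ᵇ toℕ a then tP else P.1#
    IH : ∑[ bs ∈ bars k ] M (b ∷ w) bs P.≈ weight (b ∷ w)
    IH = ∑-bars≈weight k (b ∷ w) (ℕ.suc-injective ∣w∣≡)
    no-bar : ∀ bs c → monomial ((if c then 1 else 0) ℕ.+ desW (b ∷ w) bs) (segB bs)
                      P.≈ (if c then tP else P.1#) P.* M (b ∷ w) bs
    no-bar bs true  = monomial-t (desW (b ∷ w) bs) (segB bs)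
    no-bar bs false = P.sym (P.*-identityˡ (M (b ∷ w) bs))
    bar-or-not : ∀ c → qP P.* weight (b ∷ w) P.+ ((if c then tP else P.1#) P.* weight (b ∷ w) P.+ P.0#)
                       P.≈ (if c then u else v) P.* weight (b ∷ w)
    bar-or-not true  = solve 3 (λ q t W → q :* W :+ (t :* W :+ :0) := (t :+ q) :* W) P.refl qP tP (weight (b ∷ w))
    bar-or-not false = P.trans (solve 2 (λ q W → q :* W :+ (:1 :* W :+ :0) := (:1 :+ q) :* W) P.refl qP (weight (b ∷ w)))
                               (P.*-congʳ {weight (b ∷ w)} (P.+-congʳ {qP} (P.sym (constP≈κ 1ℚ))))

  α≈permutationSum : ∀ n → α (suc n) P.≈ permutationSum (suc n)
  α≈permutationSum n = P.trans (α≈∑-bars (suc n))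
    (∑-allLists-cong (suc n) (allFin (suc n)) (λ w ∣w∣≡ → ind-cong (distinct w) (∑-bars≈weight n w ∣w∣≡)))

  α-recurrence : ∀ n → α (suc (suc n)) P.≈ (u P.+ v) P.* α (suc n) P.+ (u P.* v) P.* ∂q (α (suc n))
  α-recurrence n = begin
    α (suc (suc n))
      ≈⟨ α≈permutationSum (suc n) ⟩
    permutationSum (suc (suc n))
      ≈⟨ permutationSum-recurrence n ⟩
    (u P.+ v) P.* permutationSum (suc n) P.+ (u P.* v) P.* ∂q (permutationSum (suc n))
      ≈⟨ P.sym (P.+-cong (P.*-congˡ {u P.+ v} (α≈permutationSum n)) (P.*-congˡ {u P.* v} (∂q.cong (α≈permutationSum n)))) ⟩
    (u P.+ v) P.* α (suc n) P.+ (u P.* v) P.* ∂q (α (suc n)) ∎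

module GeneratingFunction where

  open import Defs
  open import Data.Nat using (ℕ; zero; suc)
  open import Data.Rational using (0ℚ; 1ℚ)
  open import Relation.Binary.PropositionalEquality as ≡ using (_≡_; refl)
  open SeriesRings
  open SegmentedPermutationCount using (α-recurrence)
  open import Algebra.Properties.Semiring.Mult P.semiring using (×-congʳ; ×-assoc-*) renaming (_×_ to _×ᴾ_)
  open import Data.Rational.Properties using (+-*-commutativeRing)
  open import Algebra.Properties.Semiring.Mult (CommutativeRing.semiring +-*-commutativeRing) using () renaming (_×_ to _×ℚ_)
  open import Algebra.Properties.Ring P.ring using (-0#≈0#)
  open IntegerRingSolver ℚ⟦t,q⟧ using (solve; _:=_; _:+_; _:*_; _:-_; :0; :1)
  open import Relation.Binary.Reasoning.Setoid P.setoid

  scaled : (ℕ → Poly2) → FPS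
  scaled a n = κ (invFact n) P.* a n

  egf≈scaled : ∀ a → egf a S.≈ scaled a
  egf≈scaled a n = scaleP≈κ* (invFact n) (a n)

  D-scaled : ∀ a n → Qtqx.D (scaled a) n P.≈ κ (invFact n) P.* a (suc n)
  D-scaled a n = begin
    suc n ×ᴾ (κ (invFact (suc n)) P.* a (suc n))    ≈⟨ ×-assoc-* (suc n) (κ (invFact (suc n))) (a (suc n)) ⟨
    (suc n ×ᴾ κ (invFact (suc n))) P.* a (suc n)    ≈⟨ P.*-congʳ {a (suc n)} (×ᴾ-κ (suc n) (invFact (suc n))) ⟩
    κ (suc n ×ℚ invFact (suc n)) P.* a (suc n)      ≡⟨ ≡.cong (λ c → κ c P.* a (suc n)) (RationalArithmetic.×-invFact n) ⟩
    κ (invFact n) P.* a (suc n)                     ∎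

  ι : Poly2 → FPS
  ι = Qtqx.ι

  ι-*-coefficient : ∀ a {x} → x S.≈ ι a → ∀ f n → (x S.* f) n P.≈ a P.* f n
  ι-*-coefficient a x≈ιa f n = P.trans (S.*-congʳ {f} x≈ιa n) (Qtqx.ι-⊛ a f n)

  δx : FPS → FPS
  δx = Qtqx.lift ∂q

  δx-isDerivation : Derivations.IsDerivation ℚ⟦t,q⟧⟦x⟧ δx
  δx-isDerivation = Qtqx.lift-isDerivation ∂q-isDerivation

  δx-ι : ∀ {a} → ∂q a P.≈ P.1# → δx (ι a) S.≈ S.1#
  δx-ι {a} ∂q-a≈1 = S.trans (Qtqx.lift-ι ∂q-isDerivation a) (Qtqx.ι-cong ∂q-a≈1)

  α0≈1 : α 0 P.≈ P.1#
  α0≈1 zero    zero    = refl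
  α0≈1 zero    (suc j) = refl
  α0≈1 (suc i) j       = refl

  α1≈1 : α 1 P.≈ P.1#
  α1≈1 zero    zero    = refl
  α1≈1 zero    (suc j) = refl
  α1≈1 (suc i) j       = refl

  F : FPS
  F = scaled α S.- S.1#

  F-zero : F 0 P.≈ P.0#
  F-zero = begin
    κ 1ℚ P.* α 0 P.- P.1#      ≈⟨ P.+-congʳ (P.*-congˡ {κ 1ℚ} α0≈1) ⟩
    P.1# P.* P.1# P.- P.1#     ≈⟨ solve 0 (:1 :* :1 :- :1 := :0) P.refl ⟩
    P.0#                       ∎

  F-suc : ∀ n → F (suc n) P.≈ κ (invFact (suc n)) P.* α (suc n)
  F-suc n = P.trans (P.+-congˡ {κ (invFact (suc n)) P.* α (suc n)} -0#≈0#) (P.+-identityʳ _)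

  D-F : ∀ n → Qtqx.D F n P.≈ κ (invFact n) P.* α (suc n)
  D-F n = P.trans (×-congʳ (suc n) (F-suc n)) (D-scaled α n)

  F-ode : Qtqx.D F S.≈ S.1# S.+ (ι u S.+ ι v) S.* F S.+ (ι u S.* ι v) S.* δx F
  F-ode n = P.trans (coefficient n) (P.sym (P.+-cong (P.+-congˡ {S.1# n} (ι-*-coefficient (u P.+ v) (S.sym (Qtqx.ι-homo-+ u v)) F n))
                                                      (ι-*-coefficient (u P.* v) (S.sym (Qtqx.ι-homo-* u v)) (δx F) n)))
    where
    coefficient : ∀ n → Qtqx.D F n P.≈ S.1# n P.+ (u P.+ v) P.* F n P.+ (u P.* v) P.* ∂q (F n)
    coefficient zero = begin
      Qtqx.D F 0                                      ≈⟨ D-F 0 ⟩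
      κ 1ℚ P.* α 1                                    ≈⟨ P.*-congˡ {κ 1ℚ} α1≈1 ⟩
      P.1# P.* P.1#                                   ≈⟨ solve 2 (λ s p → :1 :* :1 := :1 :+ s :* :0 :+ p :* :0) P.refl (u P.+ v) (u P.* v) ⟩
      P.1# P.+ (u P.+ v) P.* P.0# P.+ (u P.* v) P.* P.0#
        ≈⟨ P.+-cong (P.+-congˡ {P.1#} (P.*-congˡ {u P.+ v} F-zero)) (P.*-congˡ {u P.* v} (P.trans (∂q.cong F-zero) ∂q.0#↦0#)) ⟨
      P.1# P.+ (u P.+ v) P.* F 0 P.+ (u P.* v) P.* ∂q (F 0) ∎
    coefficient (suc m) = begin
      Qtqx.D F (suc m)                                ≈⟨ D-F (suc m) ⟩
      c P.* α (suc (suc m))                           ≈⟨ P.*-congˡ {c} (α-recurrence m) ⟩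
      c P.* ((u P.+ v) P.* a P.+ (u P.* v) P.* ∂q a)
        ≈⟨ solve 5 (λ c a δa u v → c :* ((u :+ v) :* a :+ (u :* v) :* δa)
                                   := :0 :+ (u :+ v) :* (c :* a) :+ (u :* v) :* (c :* δa)) P.refl c a (∂q a) u v ⟩
      P.0# P.+ (u P.+ v) P.* (c P.* a) P.+ (u P.* v) P.* (c P.* ∂q a)
        ≈⟨ P.+-cong (P.+-congˡ {P.0#} (P.*-congˡ {u P.+ v} (F-suc m)))
                    (P.*-congˡ {u P.* v} (P.trans (∂q.cong (F-suc m)) (∂q.leibniz-constantˡ c a (∂q-κ (invFact (suc m)))))) ⟨
      P.0# P.+ (u P.+ v) P.* F (suc m) P.+ (u P.* v) P.* ∂q (F (suc m)) ∎
      where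
      c = κ (invFact (suc m))
      a = α (suc m)

  w : Poly2
  w = constP 1ℚ -P tP

  E≈scaled : E S.≈ scaled (w ^P_)
  E≈scaled = egf≈scaled (w ^P_)

  ^P-suc : ∀ n → w ^P suc n P.≈ w P.* w ^P n
  ^P-suc n = *P≗⊛ w (w ^P n)

  E-zero : E 0 P.≈ P.1#
  E-zero zero    zero    = refl
  E-zero zero    (suc j) = refl
  E-zero (suc i) j       = refl

  E-ode : Qtqx.D E S.≈ (ι v S.- ι u) S.* E
  E-ode n = begin
    Qtqx.D E n                                      ≈⟨ ×-congʳ (suc n) (E≈scaled (suc n)) ⟩
    Qtqx.D (scaled (w ^P_)) n                       ≈⟨ D-scaled (w ^P_) n ⟩
    c P.* w ^P suc n                                ≈⟨ P.*-congˡ {c} (^P-suc n) ⟩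
    c P.* (w P.* w ^P n)                            ≈⟨ solve 3 (λ c w W → c :* (w :* W) := w :* (c :* W)) P.refl c w (w ^P n) ⟩
    w P.* (c P.* w ^P n)                            ≈⟨ P.*-cong (P.sym 1-t≈v-u) (E≈scaled n) ⟨
    (v P.- u) P.* E n                               ≈⟨ ι-*-coefficient (v P.- u) v-u≈ E n ⟨
    ((ι v S.- ι u) S.* E) n                         ∎
    where
    c = κ (invFact n)
    v-u≈ : ι v S.- ι u S.≈ ι (v P.- u)
    v-u≈ = S.sym (S.trans (Qtqx.ι-homo-+ v (P.- u)) (S.+-congˡ {ι v} (Qtqx.ι--‿homo u)))

  ∂q-w : ∂q w P.≈ P.0#
  ∂q-w = begin
    ∂q w                     ≈⟨ ∂q.cong 1-t≈v-u ⟩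
    ∂q (v P.- u)             ≈⟨ ∂q.−-homo v u ⟩
    ∂q v P.- ∂q u            ≈⟨ P.+-cong ∂q-v (P.-‿cong ∂q-u) ⟩
    P.1# P.- P.1#            ≈⟨ P.-‿inverseʳ P.1# ⟩
    P.0#                     ∎

  ∂q-w^n : ∀ n → ∂q (w ^P n) P.≈ P.0#
  ∂q-w^n zero    = P.trans (∂q.cong (constP≈κ 1ℚ)) (∂q-κ 1ℚ)
  ∂q-w^n (suc n) = begin
    ∂q (w ^P suc n)                         ≈⟨ ∂q.cong (^P-suc n) ⟩
    ∂q (w P.* w ^P n)                       ≈⟨ ∂q.leibniz w (w ^P n) ⟩
    ∂q w P.* w ^P n P.+ w P.* ∂q (w ^P n)   ≈⟨ P.+-cong (P.*-congʳ {w ^P n} ∂q-w) (P.*-congˡ {w} (∂q-w^n n)) ⟩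
    P.0# P.* w ^P n P.+ w P.* P.0#          ≈⟨ solve 2 (λ W w → :0 :* W :+ w :* :0 := :0) P.refl (w ^P n) w ⟩
    P.0#                                    ∎

  δx-E : δx E S.≈ S.0#
  δx-E n = begin
    ∂q (E n)                                ≈⟨ ∂q.cong (E≈scaled n) ⟩
    ∂q (c P.* w ^P n)                       ≈⟨ ∂q.leibniz-constantˡ c (w ^P n) (∂q-κ (invFact n)) ⟩
    c P.* ∂q (w ^P n)                       ≈⟨ P.*-congˡ {c} (∂q-w^n n) ⟩
    c P.* P.0#                              ≈⟨ P.zeroʳ c ⟩
    P.0#                                    ∎
    where
    c = κ (invFact n)

  residual : FPS
  residual = F S.* (ι v S.- ι u S.* E) S.- (E S.- S.1#)

  residual-ode : Qtqx.D residual S.≈ ι v S.* residual S.+ (ι u S.* ι v) S.* δx residual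
  residual-ode = ResidualEquation.residual-ode ℚ⟦t,q⟧⟦x⟧ Qtqx.D-isDerivation δx-isDerivation {F} {E} {ι u} {ι v}
                   F-ode E-ode δx-E (Qtqx.D-ι u) (Qtqx.D-ι v) (δx-ι ∂q-u) (δx-ι ∂q-v)

  residual≈0 : residual S.≈ S.0#
  residual≈0 = Qtqx.vanishing 1+n×p≈0⇒p≈0 residual residual-zero residual-step
    where
    residual-zero : residual 0 P.≈ P.0#
    residual-zero = begin
      F 0 P.* (v P.- u P.* E 0) P.- (E 0 P.- P.1#)
        ≈⟨ P.+-cong (P.*-congʳ {v P.- u P.* E 0} F-zero) (P.-‿cong (P.+-congʳ {P.- P.1#} E-zero)) ⟩
      P.0# P.* (v P.- u P.* E 0) P.- (P.1# P.- P.1#)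
        ≈⟨ solve 1 (λ d → :0 :* d :- (:1 :- :1) := :0) P.refl (v P.- u P.* E 0) ⟩
      P.0# ∎
    residual-step : ∀ n → residual n P.≈ P.0# → Qtqx.D residual n P.≈ P.0#
    residual-step n rₙ≈0 = begin
      Qtqx.D residual n
        ≈⟨ residual-ode n ⟩
      (ι v S.* residual) n P.+ ((ι u S.* ι v) S.* δx residual) n
        ≈⟨ P.+-cong (ι-*-coefficient v S.refl residual n) (ι-*-coefficient (u P.* v) (S.sym (Qtqx.ι-homo-* u v)) (δx residual) n) ⟩
      v P.* residual n P.+ (u P.* v) P.* ∂q (residual n)
        ≈⟨ P.+-cong (P.*-congˡ {v} rₙ≈0) (P.*-congˡ {u P.* v} (P.trans (∂q.cong rₙ≈0) ∂q.0#↦0#)) ⟩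
      v P.* P.0# P.+ (u P.* v) P.* P.0#
        ≈⟨ solve 2 (λ v uv → v :* :0 :+ uv :* :0 := :0) P.refl v (u P.* v) ⟩
      P.0# ∎

  constS≈ι : ∀ c → constS c S.≈ ι c
  constS≈ι c zero    = P.refl
  constS≈ι c (suc n) = P.trans (constP≈κ 0ℚ) κ-homo-0#

  oneS≈1 : oneS S.≈ S.1#
  oneS≈1 = S.trans (constS≈ι (constP 1ℚ)) (Qtqx.ι-cong (constP≈κ 1ℚ))

  G-1≈F : G -S oneS S.≈ F
  G-1≈F n = P.+-cong (egf≈scaled α n) (P.-‿cong (oneS≈1 n))

  Den≈ : Den S.≈ ι v S.- ι u S.* E
  Den≈ n = P.+-cong (constS≈ι v n) (P.-‿cong (λ i j → ≡.trans (*S≗⊛ (constS u) E n i j) (S.*-congʳ {E} (constS≈ι u) n i j)))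

  Num≈ : Num S.≈ E S.- S.1#
  Num≈ n = P.+-congˡ {E n} (P.-‿cong (oneS≈1 n))

open import Defs using (G; E; oneS; Den; Num; _-S_; _*S_; _≈S_)
open import Relation.Binary.PropositionalEquality as ≡ using (_≡_)
open SeriesRings using (module S; *S≗⊛; u; v)
open GeneratingFunction using (F; ι; G-1≈F; Den≈; Num≈; residual≈0)
open import Algebra.Properties.Ring S.ring using (x∙y⁻¹≈ε⇒x≈y)

mainTheorem11 : ((G -S oneS) *S Den) ≈S Num
mainTheorem11 n i j = ≡.trans (*S≗⊛ (G -S oneS) Den n i j) (in-series-ring n i j)
  where
  open import Relation.Binary.Reasoning.Setoid S.setoid
  in-series-ring : (G -S oneS) S.* Den S.≈ Num
  in-series-ring = begin
    (G -S oneS) S.* Den              ≈⟨ S.*-cong G-1≈F Den≈ ⟩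
    F S.* (ι v S.- ι u S.* E)        ≈⟨ x∙y⁻¹≈ε⇒x≈y _ _ residual≈0 ⟩
    E S.- S.1#                       ≈⟨ Num≈ ⟨
    Num                              ∎
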